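{- There is a probabilistic algorithm which, given $n$, an error bound $\epsilon\in(0,1)$, and black-box (oracle) access to a polynomial $P\in\mathbb{Q}[X_1,\dots,X_n]$ of total degree $D$ whose monomials have pairwise distinct supports, outputs with probability at least $1-\epsilon$ a monomial of $P$ (together with its coefficient) when $P$ is not identically zero, and makes $O\!\left(n\log\frac{n}{\epsilon}\right)$ calls to the black box, each on a point whose coordinates are integers of size $\log(2D)$.
   Context: A black box for $P$ is an oracle which, given a point $(x_1,\dots,x_n)$ of integers, returns $P(x_1,\dots,x_n)$ in unit time. The support of a monomial $X_1^{e_1}\cdots X_n^{e_n}$ is the set $\{i : e_i \geq 1\}$; "pairwise distinct supports" means no two monomials of $P$ with nonzero coefficient have the same support. The total degree of a monomial is $\sum_i e_i$, and the total degree $D$ of $P$ is the maximum total degree of its monomials. The size of an integer is its bit-length. -}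

module Defs where

open import Data.Nat as ℕ using (ℕ; zero; suc; _≤_)
open import Data.Nat.DivMod using (_/_)
open import Data.Nat.Logarithm using (⌊log₂_⌋; ⌈log₂_⌉)
open import Data.Integer as ℤ using (ℤ; ∣_∣)
open import Data.Rational as ℚ using (ℚ; ½; 0ℚ; 1ℚ; ↥_; ↧ₙ_)
open import Data.Bool using (Bool; true; false)
open import Data.Maybe using (Maybe; just; nothing)
open import Data.List using (List; []; _∷_)
open import Data.Vec using (Vec; []; _∷_; zipWith; foldr)
open import Data.Vec.Properties using (≡-dec)
open import Data.Fin using (Fin)
open import Data.Product using (_×_; _,_; ∃; Σ)
open import Data.Unit using (⊤)
open import Data.Empty using (⊥)
open import Relation.Nullary using (¬_; yes; no)
open import Relation.Binary.PropositionalEquality using (_≡_)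

-- A monomial X₁^e₁ ⋯ Xₙ^eₙ is its exponent vector.
Monomial : ℕ → Set
Monomial n = Vec ℕ n

-- A polynomial in ℚ[X₁,…,Xₙ] given as a finite list of terms (monomial, coefficient);
-- repeated monomials are added up (see coeff).
Poly : ℕ → Set
Poly n = List (Monomial n × ℚ)

coeff : ∀ {n} → Poly n → Monomial n → ℚ
coeff [] e = 0ℚ
coeff ((e' , c) ∷ P) e with ≡-dec ℕ._≟_ e' e
... | yes _ = c ℚ.+ coeff P e
... | no  _ = coeff P e

IsMonomialOf : ∀ {n} → Monomial n → Poly n → Set
IsMonomialOf e P = ¬ (coeff P e ≡ 0ℚ)

support : ∀ {n} → Monomial n → Vec Bool n
support [] = []
support (zero ∷ e) = false ∷ support e
support (suc _ ∷ e) = true ∷ support e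

DistinctSupports : ∀ {n} → Poly n → Set
DistinctSupports P = ∀ e e' → IsMonomialOf e P → IsMonomialOf e' P →
                     support e ≡ support e' → e ≡ e'

totalDeg : ∀ {n} → Monomial n → ℕ
totalDeg e = foldr _ ℕ._+_ 0 e

HasTotalDegree : ∀ {n} → Poly n → ℕ → Set
HasTotalDegree P D = (∀ e → IsMonomialOf e P → totalDeg e ≤ D)
                   × ∃ (λ e → IsMonomialOf e P × totalDeg e ≡ D)

IdenticallyZero : ∀ {n} → Poly n → Set
IdenticallyZero P = ∀ e → coeff P e ≡ 0ℚ

ℤtoℚ : ℤ → ℚ
ℤtoℚ z = z ℚ./ 1

powℚ : ℚ → ℕ → ℚ
powℚ x zero = 1ℚ
powℚ x (suc k) = x ℚ.* powℚ x k

evalMono : ∀ {n} → Monomial n → Vec ℤ n → ℚ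
evalMono e x = foldr _ ℚ._*_ 1ℚ (zipWith (λ ei xi → powℚ (ℤtoℚ xi) ei) e x)

eval : ∀ {n} → Poly n → Vec ℤ n → ℚ
eval [] x = 0ℚ
eval ((e , c) ∷ P) x = c ℚ.* evalMono e x ℚ.+ eval P x

bitLength : ℕ → ℕ
bitLength zero = zero
bitLength (suc m) = suc ⌊log₂ suc m ⌋

sizeℤ : ℤ → ℕ
sizeℤ z = bitLength ∣ z ∣

-- Probabilistic black-box algorithms for n-variate polynomials, as decision trees:
-- stop with an output, flip a fair coin, or query the black box at an integer point
-- and continue depending on the returned value.
data Alg (n : ℕ) (Out : Set) : Set where
  ret   : Out → Alg n Out
  flip  : (Bool → Alg n Out) → Alg n Out
  query : Vec ℤ n → (ℚ → Alg n Out) → Alg n Out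

Prob : ∀ {n Out} → (Vec ℤ n → ℚ) → (Out → Bool) → Alg n Out → ℚ
Prob O S (ret o) with S o
... | true  = 1ℚ
... | false = 0ℚ
Prob O S (flip k) = ½ ℚ.* (Prob O S (k false) ℚ.+ Prob O S (k true))
Prob O S (query x k) = Prob O S (k (O x))

QueriesBounded : ∀ {n Out} → (Vec ℤ n → ℚ) → ℕ → ℕ → Alg n Out → Set
QueriesBounded O q s (ret _) = ⊤
QueriesBounded O q s (flip k) = QueriesBounded O q s (k false) × QueriesBounded O q s (k true)
QueriesBounded O zero s (query x k) = ⊥
QueriesBounded O (suc q) s (query x k) =
  (∀ (i : Fin _) → sizeℤ (Data.Vec.lookup x i) ≤ s) × QueriesBounded O q s (k (O x))

Output : ℕ → Set
Output n = Maybe (Monomial n × ℚ)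

correctB : ∀ {n} → Poly n → Output n → Bool
correctB P nothing = false
correctB P (just (e , c)) with coeff P e ℚ.≟ 0ℚ
... | yes _ = false
... | no  _ with coeff P e ℚ.≟ c
...   | yes _ = true
...   | no  _ = false

-- ⌈a / b⌉ on naturals (0 when b = 0)
ceilDiv : ℕ → ℕ → ℕ
ceilDiv a zero = zero
ceilDiv a (suc b) = (a ℕ.+ b) / suc b

-- ⌈ n / ε ⌉ for a rational ε (meaningful for ε > 0)
ceil-n/ε : ℕ → ℚ → ℕ
ceil-n/ε n ε = ceilDiv (n ℕ.* ↧ₙ ε) ∣ ↥ ε ∣

module Submission where

-- Sample test points uniformly from {0, …, 2^s - 1}^n with 2^s ≥ 2D: by Schwartz–Zippel a nonzero
-- polynomial of degree ≤ D vanishes on at most half of them, so L = ⌈log₂ ⌈n/ε⌉⌉ probes detect that a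
-- polynomial is nonzero except with probability 2^-L ≤ ε/n.  Starting from all variables, go through
-- them one by one and drop a variable whenever P stays nonzero with it (and the dropped ones) set to 0.
-- If all n tests answer correctly, which happens with probability ≥ (1 - 2^-L)^n ≥ 1 - ε (Bernoulli),
-- the final set S is minimal: P restricted to S is nonzero but vanishes when any further variable of
-- S is set to 0.  Then every monomial of the restriction has support exactly S, so by the distinct
-- supports hypothesis it is a single term c·X^e; c is its value at (1, …, 1) and eᵢ is read off from
-- its value c·2^eᵢ at the point with 2 in position i.  This costs nL + n + 1 queries.  For D = 0, P is
-- a constant, read off at 0.

open import Data.Bool using (Bool; true; false; _∧_; _∨_; not; if_then_else_)
open import Data.Empty using (⊥; ⊥-elim)
open import Data.Fin as Fin using (Fin)
import Data.Fin.Properties as FinP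
open import Data.Integer as ℤ using (ℤ)
open import Data.Integer.GCD using (gcd; gcd-zeroʳ)
import Data.Integer.Properties as ℤP
import Data.Integer.Tactic.RingSolver as ℤ-Solver
open import Data.List using (List; []; _∷_; length; map; _++_; allFin)
open import Data.List.Membership.Propositional using (_∈_)
open import Data.List.Membership.Propositional.Properties using (∈-map⁻; ∈-allFin)
open import Data.List.Properties using (length-++; length-map; map-∘; length-tabulate)
open import Data.List.Relation.Unary.All as All using (All; []; _∷_)
import Data.List.Relation.Unary.All.Properties as All
open import Data.List.Relation.Unary.AllPairs using ([]; _∷_)
open import Data.List.Relation.Unary.Any as Any using (Any; here; there; any?; satisfied)
open import Data.List.Relation.Unary.Unique.Propositional using (Unique)
import Data.List.Relation.Unary.Unique.Propositional.Properties as Unique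
open import Data.Maybe using (Maybe; just; nothing)
open import Data.Nat as ℕ using (ℕ; zero; suc; _^_; _∸_; ⌊_/2⌋; ⌈_/2⌉)
open import Data.Nat.DivMod using (_/_; _%_; m≡m%n+[m/n]*n; m%n<n)
open import Data.Nat.Logarithm
import Data.Nat.Properties as ℕP
import Data.Nat.Tactic.RingSolver as ℕ-Solver
open import Data.Product using (_,_; ∃; _×_; proj₁; proj₂)
open import Data.Rational as ℚ using (ℚ; 0ℚ; 1ℚ; ½; _+_; _*_; -_; _-_; _≤_; _<_; 1/_)
open import Data.Rational.Properties
import Data.Rational.Unnormalised as ℚᵘ
import Data.Rational.Unnormalised.Properties as ℚᵘP
open import Data.Sum using (_⊎_; inj₁; inj₂; [_,_]′)
open import Data.Unit using (tt)
open import Data.Vec using (Vec; []; _∷_; lookup; replicate; _[_]≔_)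
open import Data.Vec.Properties using (≡-dec; lookup∘update; lookup∘update′; lookup-replicate)
open import Function using (id)
open import Relation.Binary.PropositionalEquality
open import Relation.Nullary using (¬_; ¬?; yes; no; Dec; does)
open import Tactic.RingSolver using (solve-∀)
open import Tactic.RingSolver.Core.AlmostCommutativeRing using (AlmostCommutativeRing; fromCommutativeRing)
open import Defs

ℚ-ring : AlmostCommutativeRing _ _
ℚ-ring = fromCommutativeRing +-*-commutativeRing decideZero
  where
  decideZero : ∀ x → Maybe (0ℚ ≡ x)
  decideZero x with 0ℚ ℚ.≟ x
  ... | yes p = just p
  ... | no _ = nothing

*-zero-product : ∀ p q → p * q ≡ 0ℚ → p ≡ 0ℚ ⊎ q ≡ 0ℚ
*-zero-product p q pq≡0 with p ℚ.≟ 0ℚ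
... | yes p≡0 = inj₁ p≡0
... | no p≢0 = inj₂ (begin
  q                ≡⟨ sym (*-identityˡ q) ⟩
  1ℚ * q           ≡⟨ cong (_* q) (sym (*-inverseˡ p)) ⟩
  (1/ p * p) * q   ≡⟨ *-assoc (1/ p) p q ⟩
  1/ p * (p * q)   ≡⟨ cong (1/ p *_) pq≡0 ⟩
  1/ p * 0ℚ        ≡⟨ *-zeroʳ (1/ p) ⟩
  0ℚ               ∎)
  where
  open ≡-Reasoning
  instance _ = ℚ.≢-nonZero p≢0

p-q≡0⇒p≡q : ∀ p q → p - q ≡ 0ℚ → p ≡ q
p-q≡0⇒p≡q p q p-q≡0 = begin
  p              ≡⟨ shift p q ⟩
  (p - q) + q    ≡⟨ cong (_+ q) p-q≡0 ⟩
  0ℚ + q         ≡⟨ +-identityˡ q ⟩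
  q              ∎
  where
  open ≡-Reasoning
  shift : ∀ p q → p ≡ (p - q) + q
  shift = solve-∀ ℚ-ring

*-cancelˡ-≢0 : ∀ c p q → ¬ c ≡ 0ℚ → c * p ≡ c * q → p ≡ q
*-cancelˡ-≢0 c p q c≢0 cp≡cq =
  p-q≡0⇒p≡q p q ([ (λ c≡0 → ⊥-elim (c≢0 c≡0)) , id ]′ (*-zero-product c (p - q) c[p-q]≡0))
  where
  open ≡-Reasoning
  distrib : ∀ c p q → c * (p - q) ≡ c * p - c * q
  distrib = solve-∀ ℚ-ring
  c[p-q]≡0 : c * (p - q) ≡ 0ℚ
  c[p-q]≡0 = begin
    c * (p - q)       ≡⟨ distrib c p q ⟩
    c * p - c * q     ≡⟨ cong (_- c * q) cp≡cq ⟩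
    c * q - c * q     ≡⟨ +-inverseʳ (c * q) ⟩
    0ℚ                ∎

0≤1 : 0ℚ ≤ 1ℚ
0≤1 = ℚ.*≤* (ℤ.+≤+ ℕ.z≤n)

0≤½ : 0ℚ ≤ ½
0≤½ = ℚ.*≤* (ℤ.+≤+ ℕ.z≤n)

½≤1 : ½ ≤ 1ℚ
½≤1 = ℚ.*≤* (ℤ.+≤+ (ℕ.s≤s ℕ.z≤n))

nonNeg-* : ∀ {p q} → 0ℚ ≤ p → 0ℚ ≤ q → 0ℚ ≤ p * q
nonNeg-* {p} 0≤p 0≤q = ≤-trans (≤-reflexive (sym (*-zeroʳ p))) (*-monoˡ-≤-nonNeg p {{ℚ.nonNegative 0≤p}} 0≤q)

p≤p+q : ∀ p {q} → 0ℚ ≤ q → p ≤ p + q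
p≤p+q p 0≤q = ≤-trans (≤-reflexive (sym (+-identityʳ p))) (+-monoʳ-≤ p 0≤q)

1-p≤1 : ∀ {p} → 0ℚ ≤ p → 1ℚ - p ≤ 1ℚ
1-p≤1 0≤p = ≤-trans (+-monoʳ-≤ 1ℚ (neg-antimono-≤ 0≤p)) (≤-reflexive (+-identityʳ 1ℚ))

0≤1-p : ∀ {p} → p ≤ 1ℚ → 0ℚ ≤ 1ℚ - p
0≤1-p {p} p≤1 = ≤-trans (≤-reflexive (sym (+-inverseʳ p))) (+-monoˡ-≤ (- p) p≤1)

half-avg : ∀ m a b → m ≤ a → m ≤ b → m ≤ ½ * (a + b)
half-avg m a b m≤a m≤b = ≤-trans (≤-reflexive (halve m)) (*-monoˡ-≤-nonNeg ½ (+-mono-≤ m≤a m≤b))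
  where
  halve : ∀ m → m ≡ ½ * (m + m)
  halve = solve-∀ ℚ-ring

powℚ-nonNeg : ∀ {x} k → 0ℚ ≤ x → 0ℚ ≤ powℚ x k
powℚ-nonNeg zero 0≤x = 0≤1
powℚ-nonNeg (suc k) 0≤x = nonNeg-* 0≤x (powℚ-nonNeg k 0≤x)

powℚ-≤1 : ∀ {x} k → 0ℚ ≤ x → x ≤ 1ℚ → powℚ x k ≤ 1ℚ
powℚ-≤1 zero _ _ = ≤-refl
powℚ-≤1 {x} (suc k) 0≤x x≤1 =
  ≤-trans (*-monoˡ-≤-nonNeg x {{ℚ.nonNegative 0≤x}} (powℚ-≤1 k 0≤x x≤1))
          (≤-trans (≤-reflexive (*-identityʳ x)) x≤1)

fromℕ : ℕ → ℚ
fromℕ zero = 0ℚ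
fromℕ (suc m) = 1ℚ + fromℕ m

fromℕ-+ : ∀ m k → fromℕ (m ℕ.+ k) ≡ fromℕ m + fromℕ k
fromℕ-+ zero k = sym (+-identityˡ (fromℕ k))
fromℕ-+ (suc m) k = trans (cong (1ℚ +_) (fromℕ-+ m k)) (sym (+-assoc 1ℚ (fromℕ m) (fromℕ k)))

fromℕ-* : ∀ m k → fromℕ (m ℕ.* k) ≡ fromℕ m * fromℕ k
fromℕ-* zero k = sym (*-zeroˡ (fromℕ k))
fromℕ-* (suc m) k = begin
  fromℕ (k ℕ.+ m ℕ.* k)         ≡⟨ fromℕ-+ k (m ℕ.* k) ⟩
  fromℕ k + fromℕ (m ℕ.* k)     ≡⟨ cong (fromℕ k +_) (fromℕ-* m k) ⟩
  fromℕ k + fromℕ m * fromℕ k   ≡⟨ factor (fromℕ m) (fromℕ k) ⟩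
  (1ℚ + fromℕ m) * fromℕ k      ∎
  where
  open ≡-Reasoning
  factor : ∀ m k → k + m * k ≡ (1ℚ + m) * k
  factor = solve-∀ ℚ-ring

fromℕ-^ : ∀ a k → fromℕ (a ^ k) ≡ powℚ (fromℕ a) k
fromℕ-^ a zero = +-identityʳ 1ℚ
fromℕ-^ a (suc k) = trans (fromℕ-* a (a ^ k)) (cong (fromℕ a *_) (fromℕ-^ a k))

fromℕ-nonNeg : ∀ m → 0ℚ ≤ fromℕ m
fromℕ-nonNeg zero = ≤-refl
fromℕ-nonNeg (suc m) = +-mono-≤ 0≤1 (fromℕ-nonNeg m)

fromℕ-pos : ∀ m → 0ℚ < fromℕ (suc m)
fromℕ-pos m = <-≤-trans (ℚ.*<* (ℤ.+<+ (ℕ.s≤s ℕ.z≤n))) (p≤p+q 1ℚ (fromℕ-nonNeg m))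

fromℕ-mono-≤ : ∀ {m k} → m ℕ.≤ k → fromℕ m ≤ fromℕ k
fromℕ-mono-≤ {m} m≤k with ℕP.m≤n⇒∃[o]m+o≡n m≤k
... | o , refl = ≤-trans (p≤p+q (fromℕ m) (fromℕ-nonNeg o)) (≤-reflexive (sym (fromℕ-+ m o)))

fromℕ-injective : ∀ a b → fromℕ a ≡ fromℕ b → a ≡ b
fromℕ-injective zero zero _ = refl
fromℕ-injective zero (suc b) eq = ⊥-elim (<-irrefl eq (fromℕ-pos b))
fromℕ-injective (suc a) zero eq = ⊥-elim (<-irrefl (sym eq) (fromℕ-pos a))
fromℕ-injective (suc a) (suc b) eq = cong suc (fromℕ-injective a b (begin
  fromℕ a                  ≡⟨ unshift (fromℕ a) ⟩
  - 1ℚ + (1ℚ + fromℕ a)    ≡⟨ cong (- 1ℚ +_) eq ⟩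
  - 1ℚ + (1ℚ + fromℕ b)    ≡⟨ unshift (fromℕ b) ⟨
  fromℕ b                  ∎))
  where
  open ≡-Reasoning
  unshift : ∀ x → x ≡ - 1ℚ + (1ℚ + x)
  unshift = solve-∀ ℚ-ring

fromℕ≤p<1⇒0 : ∀ m {p} → fromℕ m ≤ p → p < 1ℚ → m ≡ 0
fromℕ≤p<1⇒0 zero _ _ = refl
fromℕ≤p<1⇒0 (suc m) m≤p p<1 =
  ⊥-elim (<-irrefl refl (≤-<-trans (≤-trans (p≤p+q 1ℚ (fromℕ-nonNeg m)) m≤p) p<1))

bernoulli : ∀ n d → 0ℚ ≤ d → d ≤ 1ℚ → 1ℚ - fromℕ n * d ≤ powℚ (1ℚ - d) n
bernoulli zero d _ _ = ≤-reflexive (cong (λ x → 1ℚ - x) (*-zeroˡ d))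
bernoulli (suc n) d 0≤d d≤1 = begin
  1ℚ - (1ℚ + fromℕ n) * d                         ≤⟨ p≤p+q _ (nonNeg-* (fromℕ-nonNeg n) (nonNeg-* 0≤d 0≤d)) ⟩
  1ℚ - (1ℚ + fromℕ n) * d + fromℕ n * (d * d)     ≡⟨ expand (fromℕ n) d ⟩
  (1ℚ - d) * (1ℚ - fromℕ n * d)                   ≤⟨ *-monoˡ-≤-nonNeg (1ℚ - d) {{ℚ.nonNegative (0≤1-p d≤1)}}
                                                       (bernoulli n d 0≤d d≤1) ⟩
  (1ℚ - d) * powℚ (1ℚ - d) n                      ∎
  where
  open ≤-Reasoning
  expand : ∀ n d → 1ℚ - (1ℚ + n) * d + n * (d * d) ≡ (1ℚ - d) * (1ℚ - n * d)
  expand = solve-∀ ℚ-ring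

fromℕ-2^*½^ : ∀ L → fromℕ (2 ^ L) * powℚ ½ L ≡ 1ℚ
fromℕ-2^*½^ zero = refl
fromℕ-2^*½^ (suc L) = begin
  fromℕ (2 ^ suc L) * (½ * powℚ ½ L)            ≡⟨ cong (_* (½ * powℚ ½ L)) (fromℕ-* 2 (2 ^ L)) ⟩
  fromℕ 2 * fromℕ (2 ^ L) * (½ * powℚ ½ L)      ≡⟨ regroup (fromℕ (2 ^ L)) (powℚ ½ L) ⟩
  fromℕ (2 ^ L) * powℚ ½ L                      ≡⟨ fromℕ-2^*½^ L ⟩
  1ℚ                                            ∎
  where
  open ≡-Reasoning
  regroup : ∀ x y → fromℕ 2 * x * (½ * y) ≡ x * y
  regroup = solve-∀ ℚ-ring

NonZeroPoly : ∀ {n} → Poly n → Set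
NonZeroPoly Q = ∃ λ e → IsMonomialOf e Q

DegreeAtMost : ∀ {n} → Poly n → ℕ → Set
DegreeAtMost Q D = ∀ e → IsMonomialOf e Q → totalDeg e ℕ.≤ D

Occurs : ∀ {n} → Monomial n → Poly n → Set
Occurs e Q = Any (λ t → proj₁ t ≡ e) Q

monomial⇒occurs : ∀ {n} (Q : Poly n) {e} → IsMonomialOf e Q → Occurs e Q
monomial⇒occurs [] nz = ⊥-elim (nz refl)
monomial⇒occurs ((e' , c) ∷ Q) {e} nz with ≡-dec ℕ._≟_ e' e
... | yes e'≡e = here e'≡e
... | no _ = there (monomial⇒occurs Q nz)

nonZero? : ∀ {n} (Q : Poly n) → Dec (NonZeroPoly Q)
nonZero? Q with any? (λ t → ¬? (coeff Q (proj₁ t) ℚ.≟ 0ℚ)) Q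
... | yes found = let (t , nz) = satisfied found in yes (proj₁ t , nz)
... | no none = no λ (e , nz) → none (Any.map (λ { refl → nz }) (monomial⇒occurs Q nz))

¬nonZero⇒identicallyZero : ∀ {n} (Q : Poly n) → ¬ NonZeroPoly Q → IdenticallyZero Q
¬nonZero⇒identicallyZero Q ¬nz f with coeff Q f ℚ.≟ 0ℚ
... | yes z = z
... | no nz = ⊥-elim (¬nz (f , nz))

coeff-cons-self : ∀ {n} e c (Q : Poly n) → coeff ((e , c) ∷ Q) e ≡ c + coeff Q e
coeff-cons-self e c Q with ≡-dec ℕ._≟_ e e
... | yes _ = refl
... | no e≢e = ⊥-elim (e≢e refl)

coeff-cons-other : ∀ {n} {e f} c (Q : Poly n) → ¬ f ≡ e → coeff ((e , c) ∷ Q) f ≡ coeff Q f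
coeff-cons-other {e = e} {f} c Q f≢e with ≡-dec ℕ._≟_ e f
... | yes refl = ⊥-elim (f≢e refl)
... | no _ = refl

removeMonomial : ∀ {n} → Monomial n → Poly n → Poly n
removeMonomial e [] = []
removeMonomial e ((e' , c) ∷ Q) with ≡-dec ℕ._≟_ e' e
... | yes _ = removeMonomial e Q
... | no _ = (e' , c) ∷ removeMonomial e Q

length-removeMonomial : ∀ {n} e (Q : Poly n) → length (removeMonomial e Q) ℕ.≤ length Q
length-removeMonomial e [] = ℕ.z≤n
length-removeMonomial e ((e' , c) ∷ Q) with ≡-dec ℕ._≟_ e' e
... | yes _ = ℕP.m≤n⇒m≤1+n (length-removeMonomial e Q)
... | no _ = ℕ.s≤s (length-removeMonomial e Q)

coeff-removeMonomial-self : ∀ {n} e (Q : Poly n) → coeff (removeMonomial e Q) e ≡ 0ℚ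
coeff-removeMonomial-self e [] = refl
coeff-removeMonomial-self e ((e' , c) ∷ Q) with ≡-dec ℕ._≟_ e' e
... | yes _ = coeff-removeMonomial-self e Q
... | no e'≢e = trans (coeff-cons-other c (removeMonomial e Q) (λ e≡e' → e'≢e (sym e≡e')))
                      (coeff-removeMonomial-self e Q)

coeff-removeMonomial-other : ∀ {n} {e f} (Q : Poly n) → ¬ f ≡ e → coeff (removeMonomial e Q) f ≡ coeff Q f
coeff-removeMonomial-other [] _ = refl
coeff-removeMonomial-other {e = e} {f} ((e' , c) ∷ Q) f≢e with ≡-dec ℕ._≟_ e' e
... | yes refl = trans (coeff-removeMonomial-other Q f≢e) (sym (coeff-cons-other c Q f≢e))
... | no _ with ≡-dec ℕ._≟_ e' f
...   | yes _ = cong (c +_) (coeff-removeMonomial-other Q f≢e)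
...   | no _ = coeff-removeMonomial-other Q f≢e

removeMonomial-identicallyZero : ∀ {n} e (Q : Poly n) → (∀ f → ¬ f ≡ e → coeff Q f ≡ 0ℚ) →
                                 IdenticallyZero (removeMonomial e Q)
removeMonomial-identicallyZero e Q others f with ≡-dec ℕ._≟_ f e
... | yes refl = coeff-removeMonomial-self f Q
... | no f≢e = trans (coeff-removeMonomial-other Q f≢e) (others f f≢e)

eval-removeMonomial : ∀ {n} e (Q : Poly n) x →
                      eval Q x ≡ coeff Q e * evalMono e x + eval (removeMonomial e Q) x
eval-removeMonomial e [] x = sym (trans (cong (_+ 0ℚ) (*-zeroˡ (evalMono e x))) (+-identityˡ 0ℚ))
eval-removeMonomial e ((e' , c) ∷ Q) x with ≡-dec ℕ._≟_ e' e
... | yes refl = trans (cong (c * evalMono e' x +_) (eval-removeMonomial e' Q x))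
                       (collect c (evalMono e' x) (coeff Q e') (eval (removeMonomial e' Q) x))
  where
  collect : ∀ c m a r → c * m + (a * m + r) ≡ (c + a) * m + r
  collect = solve-∀ ℚ-ring
... | no _ = trans (cong (c * evalMono e' x +_) (eval-removeMonomial e Q x))
                   (swap (c * evalMono e' x) (coeff Q e * evalMono e x) (eval (removeMonomial e Q) x))
  where
  swap : ∀ a b r → a + (b + r) ≡ b + (a + r)
  swap = solve-∀ ℚ-ring

eval-identicallyZero : ∀ {n} (Q : Poly n) → IdenticallyZero Q → ∀ x → eval Q x ≡ 0ℚ
eval-identicallyZero Q = go (length Q) Q ℕP.≤-refl
  where
  -- induction on the number of terms, which removeMonomial decreases
  go : ∀ {n} k (Q : Poly n) → length Q ℕ.≤ k → IdenticallyZero Q → ∀ x → eval Q x ≡ 0ℚ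
  go k [] _ _ x = refl
  go (suc k) ((e , c) ∷ Q) (ℕ.s≤s len) Q≡0 x = begin
    c * evalMono e x + eval Q x                                         ≡⟨ cong (c * evalMono e x +_) (eval-removeMonomial e Q x) ⟩
    c * evalMono e x + (coeff Q e * evalMono e x + eval Q' x)           ≡⟨ collect c (evalMono e x) (coeff Q e) (eval Q' x) ⟩
    (c + coeff Q e) * evalMono e x + eval Q' x                          ≡⟨ cong₂ (λ a b → a * evalMono e x + b) c+coeff≡0 Q'≡0 ⟩
    0ℚ * evalMono e x + 0ℚ                                              ≡⟨ cong (_+ 0ℚ) (*-zeroˡ (evalMono e x)) ⟩
    0ℚ                                                                  ∎
    where
    open ≡-Reasoning
    Q' = removeMonomial e Q
    collect : ∀ c m a r → c * m + (a * m + r) ≡ (c + a) * m + r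
    collect = solve-∀ ℚ-ring
    c+coeff≡0 : c + coeff Q e ≡ 0ℚ
    c+coeff≡0 = trans (sym (coeff-cons-self e c Q)) (Q≡0 e)
    Q'≡0 : eval Q' x ≡ 0ℚ
    Q'≡0 = go k Q' (ℕP.≤-trans (length-removeMonomial e Q) len)
             (removeMonomial-identicallyZero e Q (λ f f≢e → trans (sym (coeff-cons-other c Q f≢e)) (Q≡0 f))) x

eval-single : ∀ {n} (Q : Poly n) e → (∀ f → ¬ f ≡ e → coeff Q f ≡ 0ℚ) →
              ∀ x → eval Q x ≡ coeff Q e * evalMono e x
eval-single Q e others x = begin
  eval Q x                                                   ≡⟨ eval-removeMonomial e Q x ⟩
  coeff Q e * evalMono e x + eval (removeMonomial e Q) x     ≡⟨ cong (coeff Q e * evalMono e x +_) (eval-identicallyZero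
                                                                  (removeMonomial e Q) (removeMonomial-identicallyZero e Q others) x) ⟩
  coeff Q e * evalMono e x + 0ℚ                              ≡⟨ +-identityʳ _ ⟩
  coeff Q e * evalMono e x                                   ∎
  where open ≡-Reasoning

-- Restriction to a set of variables

supportedIn : ∀ {n} → Vec Bool n → Monomial n → Bool
supportedIn [] [] = true
supportedIn (b ∷ S) (zero ∷ e) = supportedIn S e
supportedIn (b ∷ S) (suc _ ∷ e) = b ∧ supportedIn S e

restrict : ∀ {n} → Vec Bool n → Poly n → Poly n
restrict S [] = []
restrict S ((e , c) ∷ P) with supportedIn S e
... | true = (e , c) ∷ restrict S P
... | false = restrict S P

zeroOutside : ∀ {n} → Vec Bool n → Vec ℤ n → Vec ℤ n
zeroOutside [] [] = []
zeroOutside (true ∷ S) (x ∷ xs) = x ∷ zeroOutside S xs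
zeroOutside (false ∷ S) (x ∷ xs) = ℤ.+ 0 ∷ zeroOutside S xs

coeff-restrict-in : ∀ {n} S (P : Poly n) f → supportedIn S f ≡ true → coeff (restrict S P) f ≡ coeff P f
coeff-restrict-in S [] f _ = refl
coeff-restrict-in S ((e , c) ∷ P) f f∈S with supportedIn S e in e∈S
... | true with ≡-dec ℕ._≟_ e f
...   | yes _ = cong (c +_) (coeff-restrict-in S P f f∈S)
...   | no _ = coeff-restrict-in S P f f∈S
coeff-restrict-in S ((e , c) ∷ P) f f∈S | false with ≡-dec ℕ._≟_ e f
...   | yes refl with () ← trans (sym e∈S) f∈S
...   | no _ = coeff-restrict-in S P f f∈S

coeff-restrict-out : ∀ {n} S (P : Poly n) f → supportedIn S f ≡ false → coeff (restrict S P) f ≡ 0ℚ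
coeff-restrict-out S [] f _ = refl
coeff-restrict-out S ((e , c) ∷ P) f f∉S with supportedIn S e in e∈S
... | false = coeff-restrict-out S P f f∉S
... | true with ≡-dec ℕ._≟_ e f
...   | yes refl with () ← trans (sym e∈S) f∉S
...   | no _ = coeff-restrict-out S P f f∉S

evalMono-zeroOutside-in : ∀ {n} (S : Vec Bool n) e x → supportedIn S e ≡ true →
                          evalMono e (zeroOutside S x) ≡ evalMono e x
evalMono-zeroOutside-in [] [] [] _ = refl
evalMono-zeroOutside-in (true ∷ S) (j ∷ e) (y ∷ ys) e∈S =
  cong (powℚ (ℤtoℚ y) j *_) (evalMono-zeroOutside-in S e ys (lemma j e∈S))
  where lemma : ∀ j → supportedIn (true ∷ S) (j ∷ e) ≡ true → supportedIn S e ≡ true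
        lemma zero h = h
        lemma (suc _) h = h
evalMono-zeroOutside-in (false ∷ S) (zero ∷ e) (y ∷ ys) e∈S = cong (1ℚ *_) (evalMono-zeroOutside-in S e ys e∈S)

evalMono-zeroOutside-out : ∀ {n} (S : Vec Bool n) e x → supportedIn S e ≡ false →
                           evalMono e (zeroOutside S x) ≡ 0ℚ
evalMono-zeroOutside-out [] [] [] ()
evalMono-zeroOutside-out (true ∷ S) (j ∷ e) (y ∷ ys) e∉S =
  trans (cong (powℚ (ℤtoℚ y) j *_) (evalMono-zeroOutside-out S e ys (lemma j e∉S))) (*-zeroʳ (powℚ (ℤtoℚ y) j))
  where lemma : ∀ j → supportedIn (true ∷ S) (j ∷ e) ≡ false → supportedIn S e ≡ false
        lemma zero h = h
        lemma (suc _) h = h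
evalMono-zeroOutside-out (false ∷ S) (zero ∷ e) (y ∷ ys) e∉S =
  trans (cong (1ℚ *_) (evalMono-zeroOutside-out S e ys e∉S)) (*-zeroʳ 1ℚ)
evalMono-zeroOutside-out (false ∷ S) (suc j ∷ e) (y ∷ ys) _ =
  trans (cong (_* evalMono e (zeroOutside S ys)) (*-zeroˡ (powℚ 0ℚ j))) (*-zeroˡ (evalMono e (zeroOutside S ys)))

eval-zeroOutside : ∀ {n} S (P : Poly n) x → eval P (zeroOutside S x) ≡ eval (restrict S P) x
eval-zeroOutside S [] x = refl
eval-zeroOutside S ((e , c) ∷ P) x with supportedIn S e in e∈S
... | true = cong₂ (λ a b → c * a + b) (evalMono-zeroOutside-in S e x e∈S) (eval-zeroOutside S P x)
... | false = begin
  c * evalMono e (zeroOutside S x) + eval P (zeroOutside S x)   ≡⟨ cong₂ (λ a b → c * a + b)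
                                                                    (evalMono-zeroOutside-out S e x e∈S) (eval-zeroOutside S P x) ⟩
  c * 0ℚ + eval (restrict S P) x                                 ≡⟨ cong (_+ eval (restrict S P) x) (*-zeroʳ c) ⟩
  0ℚ + eval (restrict S P) x                                     ≡⟨ +-identityˡ _ ⟩
  eval (restrict S P) x                                          ∎
  where open ≡-Reasoning

count : {A : Set} → (A → Bool) → List A → ℕ
count f [] = 0
count f (x ∷ L) = if f x then suc (count f L) else count f L

count-≤-length : {A : Set} (f : A → Bool) (L : List A) → count f L ℕ.≤ length L
count-≤-length f [] = ℕ.z≤n
count-≤-length f (x ∷ L) with f x
... | true = ℕ.s≤s (count-≤-length f L)
... | false = ℕP.m≤n⇒m≤1+n (count-≤-length f L)

count-none : {A : Set} (f : A → Bool) {L : List A} → All (λ x → f x ≡ false) L → count f L ≡ 0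
count-none f [] = refl
count-none f {x ∷ _} (fx ∷ rest) rewrite fx = count-none f rest

count-mono : {A : Set} (f g : A → Bool) → (∀ x → f x ≡ true → g x ≡ true) → ∀ L → count f L ℕ.≤ count g L
count-mono f g f⇒g [] = ℕ.z≤n
count-mono f g f⇒g (x ∷ L) with f x in fx | g x in gx
... | true  | true = ℕ.s≤s (count-mono f g f⇒g L)
... | true  | false with () ← trans (sym gx) (f⇒g x fx)
... | false | true = ℕP.m≤n⇒m≤1+n (count-mono f g f⇒g L)
... | false | false = count-mono f g f⇒g L

count-∨ : {A : Set} (f g : A → Bool) (L : List A) → count (λ x → f x ∨ g x) L ℕ.≤ count f L ℕ.+ count g L
count-∨ f g [] = ℕ.z≤n
count-∨ f g (x ∷ L) with f x | g x
... | true  | true = ℕ.s≤s (ℕP.≤-trans (count-∨ f g L) (ℕP.+-monoʳ-≤ (count f L) (ℕP.n≤1+n (count g L))))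
... | true  | false = ℕ.s≤s (count-∨ f g L)
... | false | true = ℕP.≤-trans (ℕ.s≤s (count-∨ f g L)) (ℕP.≤-reflexive (sym (ℕP.+-suc _ _)))
... | false | false = count-∨ f g L

count-++ : {A : Set} (f : A → Bool) (X Y : List A) → count f (X ++ Y) ≡ count f X ℕ.+ count f Y
count-++ f [] Y = refl
count-++ f (x ∷ X) Y with f x
... | true = cong suc (count-++ f X Y)
... | false = count-++ f X Y

count-map : {A B : Set} (f : B → Bool) (g : A → B) (L : List A) → count f (map g L) ≡ count (λ x → f (g x)) L
count-map f g [] = refl
count-map f g (x ∷ L) with f (g x)
... | true = cong suc (count-map f g L)
... | false = count-map f g L

count-cong : {A : Set} {f g : A → Bool} → (∀ x → f x ≡ g x) → ∀ L → count f L ≡ count g L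
count-cong f≗g [] = refl
count-cong {g = g} f≗g (x ∷ L) rewrite f≗g x with g x
... | true = cong suc (count-cong f≗g L)
... | false = count-cong f≗g L

isZero : ℚ → Bool
isZero q = does (q ℚ.≟ 0ℚ)

isZero-true : ∀ {q} → isZero q ≡ true → q ≡ 0ℚ
isZero-true {q} h with q ℚ.≟ 0ℚ
... | yes q≡0 = q≡0

isZero-false : ∀ {q} → isZero q ≡ false → ¬ q ≡ 0ℚ
isZero-false {q} h with q ℚ.≟ 0ℚ
... | no q≢0 = q≢0

count-≡-unique : ∀ r (L : List ℚ) → Unique L → count (λ x → does (x ℚ.≟ r)) L ℕ.≤ 1
count-≡-unique r [] _ = ℕ.z≤n
count-≡-unique r (x ∷ L) (x∉L ∷ unique) with x ℚ.≟ r
... | yes refl = ℕ.s≤s (ℕP.≤-reflexive (count-none _ (All.map differs x∉L)))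
  where differs : ∀ {y} → ¬ x ≡ y → does (y ℚ.≟ x) ≡ false
        differs {y} x≢y with y ℚ.≟ x
        ... | yes y≡x = ⊥-elim (x≢y (sym y≡x))
        ... | no _ = refl
... | no _ = count-≡-unique r L unique

-- A univariate polynomial is given by its coefficient vector, constant coefficient first.

horner : ∀ {m} → Vec ℚ m → ℚ → ℚ
horner [] x = 0ℚ
horner (a ∷ v) x = a + x * horner v x

leadingCoeff : ∀ {m} → Vec ℚ (suc m) → ℚ
leadingCoeff (a ∷ []) = a
leadingCoeff (a ∷ b ∷ v) = leadingCoeff (b ∷ v)

addConstant : ∀ {m} → ℚ → Vec ℚ (suc m) → Vec ℚ (suc m)
addConstant a (b ∷ v) = (a + b) ∷ v

mulLinear : ∀ {m} → ℚ → Vec ℚ m → Vec ℚ (suc m)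
mulLinear r [] = 0ℚ ∷ []
mulLinear r (q₀ ∷ q) = (- r * q₀) ∷ addConstant q₀ (mulLinear r q)

horner-addConstant : ∀ {m} a (v : Vec ℚ (suc m)) x → horner (addConstant a v) x ≡ a + horner v x
horner-addConstant a (b ∷ w) x = assoc a b (x * horner w x)
  where assoc : ∀ a b c → (a + b) + c ≡ a + (b + c)
        assoc = solve-∀ ℚ-ring

horner-mulLinear : ∀ {m} r (q : Vec ℚ m) x → horner (mulLinear r q) x ≡ (x - r) * horner q x
horner-mulLinear r [] x = identity x r
  where identity : ∀ x r → 0ℚ + x * 0ℚ ≡ (x - r) * 0ℚ
        identity = solve-∀ ℚ-ring
horner-mulLinear r (q₀ ∷ q) x = begin
  - r * q₀ + x * horner (addConstant q₀ (mulLinear r q)) x   ≡⟨ cong (λ z → - r * q₀ + x * z)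
                                                                  (horner-addConstant q₀ (mulLinear r q) x) ⟩
  - r * q₀ + x * (q₀ + horner (mulLinear r q) x)             ≡⟨ cong (λ z → - r * q₀ + x * (q₀ + z))
                                                                  (horner-mulLinear r q x) ⟩
  - r * q₀ + x * (q₀ + (x - r) * horner q x)                 ≡⟨ identity x r q₀ (horner q x) ⟩
  (x - r) * (q₀ + x * horner q x)                            ∎
  where
  open ≡-Reasoning
  identity : ∀ x r q₀ h → - r * q₀ + x * (q₀ + (x - r) * h) ≡ (x - r) * (q₀ + x * h)
  identity = solve-∀ ℚ-ring

leadingCoeff-addConstant : ∀ {m} a (v : Vec ℚ (suc (suc m))) → leadingCoeff (addConstant a v) ≡ leadingCoeff v
leadingCoeff-addConstant a (b ∷ c ∷ v) = refl

leadingCoeff-mulLinear : ∀ {m} r (q : Vec ℚ (suc m)) → leadingCoeff (mulLinear r q) ≡ leadingCoeff q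
leadingCoeff-mulLinear r (q₀ ∷ []) = +-identityʳ q₀
leadingCoeff-mulLinear r (q₀ ∷ q₁ ∷ q) =
  trans (leadingCoeff-addConstant q₀ (mulLinear r (q₁ ∷ q))) (leadingCoeff-mulLinear r (q₁ ∷ q))

factor-root : ∀ {m} (p : Vec ℚ (suc m)) r → horner p r ≡ 0ℚ → ∃ λ q → p ≡ mulLinear r q
factor-root {zero} (a ∷ []) r pr≡0 = [] , cong (_∷ []) (trans (sym (identity a r)) pr≡0)
  where identity : ∀ a r → a + r * 0ℚ ≡ a
        identity = solve-∀ ℚ-ring
factor-root {suc m} (a ∷ p) r pr≡0 =
  let (q , p'≡) = factor-root (addConstant (- c) p) r p'r≡0
  in (c ∷ q) , cong₂ _∷_ a≡ (begin
       p                                        ≡⟨ cancel p ⟨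
       addConstant c (addConstant (- c) p)      ≡⟨ cong (addConstant c) p'≡ ⟩
       addConstant c (mulLinear r q)            ∎)
  where
  open ≡-Reasoning
  c = horner p r
  p'r≡0 : horner (addConstant (- c) p) r ≡ 0ℚ
  p'r≡0 = trans (horner-addConstant (- c) p r) (+-inverseˡ c)
  a≡ : a ≡ - r * c
  a≡ = begin
    a                        ≡⟨ split a r c ⟩
    (a + r * c) + - r * c    ≡⟨ cong (_+ - r * c) pr≡0 ⟩
    0ℚ + - r * c             ≡⟨ +-identityˡ _ ⟩
    - r * c                  ∎
    where split : ∀ a r c → a ≡ (a + r * c) + - r * c
          split = solve-∀ ℚ-ring
  cancel : ∀ {m} (v : Vec ℚ (suc m)) → addConstant c (addConstant (- c) v) ≡ v
  cancel (b ∷ v) = cong (_∷ v) (identity c b)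
    where identity : ∀ c b → c + (- c + b) ≡ b
          identity = solve-∀ ℚ-ring

rootOrNone : (f : ℚ → ℚ) (L : List ℚ) → (∃ λ r → f r ≡ 0ℚ) ⊎ All (λ x → isZero (f x) ≡ false) L
rootOrNone f [] = inj₂ []
rootOrNone f (x ∷ L) with f x ℚ.≟ 0ℚ in fx | rootOrNone f L
... | yes fx≡0 | _ = inj₁ (x , fx≡0)
... | no _ | inj₁ root = inj₁ root
... | no _ | inj₂ none = inj₂ (cong does fx ∷ none)

roots≤degree : ∀ m (p : Vec ℚ (suc m)) → ¬ leadingCoeff p ≡ 0ℚ → ∀ L → Unique L →
               count (λ x → isZero (horner p x)) L ℕ.≤ m
roots≤degree m p lead≢0 L unique with rootOrNone (horner p) L
... | inj₂ none = ℕP.≤-trans (ℕP.≤-reflexive (count-none _ none)) ℕ.z≤n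
roots≤degree zero (a ∷ []) lead≢0 L unique | inj₁ (r , pr≡0) =
  ⊥-elim (lead≢0 (trans (sym (identity a r)) pr≡0))
  where identity : ∀ a r → a + r * 0ℚ ≡ a
        identity = solve-∀ ℚ-ring
roots≤degree (suc m) p lead≢0 L unique | inj₁ (r , pr≡0) with factor-root p r pr≡0
... | q , refl = begin
  count (λ x → isZero (horner (mulLinear r q) x)) L                       ≤⟨ count-mono _ _ root-of-factor L ⟩
  count (λ x → does (x ℚ.≟ r) ∨ isZero (horner q x)) L                    ≤⟨ count-∨ _ _ L ⟩
  count (λ x → does (x ℚ.≟ r)) L ℕ.+ count (λ x → isZero (horner q x)) L  ≤⟨ ℕP.+-mono-≤ (count-≡-unique r L unique)
                                                                              (roots≤degree m q lead-q≢0 L unique) ⟩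
  suc m                                                                   ∎
  where
  open ℕP.≤-Reasoning
  lead-q≢0 : ¬ leadingCoeff q ≡ 0ℚ
  lead-q≢0 q≡0 = lead≢0 (trans (leadingCoeff-mulLinear r q) q≡0)
  root-of-factor : ∀ x → isZero (horner (mulLinear r q) x) ≡ true → does (x ℚ.≟ r) ∨ isZero (horner q x) ≡ true
  root-of-factor x h with x ℚ.≟ r
  ... | yes _ = refl
  ... | no x≢r with horner q x ℚ.≟ 0ℚ
  ...   | yes _ = refl
  ...   | no qx≢0 = ⊥-elim ([ (λ x-r≡0 → x≢r (p-q≡0⇒p≡q x r x-r≡0)) , qx≢0 ]′
                        (*-zero-product (x - r) (horner q x) (trans (sym (horner-mulLinear r q x)) (isZero-true h))))

-- The Schwartz–Zippel bound on a grid

slice : ∀ {n} → ℕ → Poly (suc n) → Poly n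
slice j [] = []
slice j ((i ∷ t , c) ∷ Q) with i ℕ.≟ j
... | yes _ = (t , c) ∷ slice j Q
... | no _ = slice j Q

coeff-slice : ∀ {n} j (Q : Poly (suc n)) t → coeff (slice j Q) t ≡ coeff Q (j ∷ t)
coeff-slice j [] t = refl
coeff-slice j ((i ∷ t' , c) ∷ Q) t with i ℕ.≟ j
... | yes refl with ≡-dec ℕ._≟_ t' t | ≡-dec ℕ._≟_ (i ∷ t') (i ∷ t)
...   | yes _    | yes _ = cong (c +_) (coeff-slice j Q t)
...   | yes refl | no ne = ⊥-elim (ne refl)
...   | no ne    | yes refl = ⊥-elim (ne refl)
...   | no _     | no _ = coeff-slice j Q t
coeff-slice j ((i ∷ t' , c) ∷ Q) t | no i≢j with ≡-dec ℕ._≟_ (i ∷ t') (j ∷ t)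
...   | yes refl = ⊥-elim (i≢j refl)
...   | no _ = coeff-slice j Q t

coeffVec : (ℕ → ℚ) → ∀ m → Vec ℚ m
coeffVec f zero = []
coeffVec f (suc m) = f 0 ∷ coeffVec (λ i → f (suc i)) m

horner-coeffVec-cong : ∀ {f g} m x → (∀ i → f i ≡ g i) → horner (coeffVec f m) x ≡ horner (coeffVec g m) x
horner-coeffVec-cong zero x f≗g = refl
horner-coeffVec-cong (suc m) x f≗g =
  cong₂ (λ a b → a + x * b) (f≗g 0) (horner-coeffVec-cong m x (λ i → f≗g (suc i)))

horner-coeffVec-+ : ∀ f g m x → horner (coeffVec (λ i → f i + g i) m) x ≡ horner (coeffVec f m) x + horner (coeffVec g m) x
horner-coeffVec-+ f g zero x = sym (+-identityˡ 0ℚ)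
horner-coeffVec-+ f g (suc m) x =
  trans (cong (λ z → (f 0 + g 0) + x * z) (horner-coeffVec-+ (λ i → f (suc i)) (λ i → g (suc i)) m x))
        (regroup (f 0) (g 0) x (horner (coeffVec (λ i → f (suc i)) m) x) (horner (coeffVec (λ i → g (suc i)) m) x))
  where regroup : ∀ a b x u w → (a + b) + x * (u + w) ≡ (a + x * u) + (b + x * w)
        regroup = solve-∀ ℚ-ring

horner-coeffVec-0 : ∀ f m x → (∀ i → f i ≡ 0ℚ) → horner (coeffVec f m) x ≡ 0ℚ
horner-coeffVec-0 f zero x f≡0 = refl
horner-coeffVec-0 f (suc m) x f≡0 =
  trans (cong₂ (λ a b → a + x * b) (f≡0 0) (horner-coeffVec-0 _ m x (λ i → f≡0 (suc i))))
        (trans (+-identityˡ _) (*-zeroʳ x))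

horner-coeffVec-truncate : ∀ f K m x → K ℕ.≤ m → (∀ i → K ℕ.≤ i → f i ≡ 0ℚ) →
                           horner (coeffVec f m) x ≡ horner (coeffVec f K) x
horner-coeffVec-truncate f zero m x _ f≡0 = horner-coeffVec-0 f m x (λ i → f≡0 i ℕ.z≤n)
horner-coeffVec-truncate f (suc K) (suc m) x (ℕ.s≤s K≤m) f≡0 =
  cong (λ z → f 0 + x * z) (horner-coeffVec-truncate _ K m x K≤m (λ i K≤i → f≡0 (suc i) (ℕ.s≤s K≤i)))

leadingCoeff-coeffVec : ∀ f k → leadingCoeff (coeffVec f (suc k)) ≡ f k
leadingCoeff-coeffVec f zero = refl
leadingCoeff-coeffVec f (suc k) = leadingCoeff-coeffVec (λ i → f (suc i)) k

single : ℕ → ℚ → ℕ → ℚ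
single zero v zero = v
single zero v (suc i) = 0ℚ
single (suc j) v zero = 0ℚ
single (suc j) v (suc i) = single j v i

single-self : ∀ j v → single j v j ≡ v
single-self zero v = refl
single-self (suc j) v = single-self j v

single-other : ∀ j v i → ¬ i ≡ j → single j v i ≡ 0ℚ
single-other zero v zero i≢j = ⊥-elim (i≢j refl)
single-other zero v (suc i) _ = refl
single-other (suc j) v zero _ = refl
single-other (suc j) v (suc i) i≢j = single-other j v i (λ i≡j → i≢j (cong suc i≡j))

horner-coeffVec-single : ∀ j v m x → j ℕ.< m → horner (coeffVec (single j v) m) x ≡ powℚ x j * v
horner-coeffVec-single zero v (suc m) x _ =
  trans (cong (λ z → v + x * z) (horner-coeffVec-0 _ m x (λ _ → refl)))
        (trans (cong (v +_) (*-zeroʳ x)) (trans (+-identityʳ v) (sym (*-identityˡ v))))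
horner-coeffVec-single (suc j) v (suc m) x (ℕ.s≤s j<m) =
  trans (cong (λ z → 0ℚ + x * z) (horner-coeffVec-single j v m x j<m))
        (trans (+-identityˡ _) (sym (*-assoc x (powℚ x j) v)))

FirstExponentsBelow : ∀ {n} → Poly (suc n) → ℕ → Set
FirstExponentsBelow Q M = All (λ t → Data.Vec.head (proj₁ t) ℕ.< M) Q

maxFirstExponent : ∀ {n} → Poly (suc n) → ℕ
maxFirstExponent [] = 0
maxFirstExponent ((i ∷ t , c) ∷ Q) = i ℕ.⊔ maxFirstExponent Q

firstExponentsBelow-max : ∀ {n} (Q : Poly (suc n)) → FirstExponentsBelow Q (suc (maxFirstExponent Q))
firstExponentsBelow-max [] = []
firstExponentsBelow-max ((i ∷ t , c) ∷ Q) =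
  ℕ.s≤s (ℕP.m≤m⊔n i (maxFirstExponent Q)) ∷
  All.map (λ lt → ℕP.<-≤-trans lt (ℕ.s≤s (ℕP.m≤n⊔m i (maxFirstExponent Q)))) (firstExponentsBelow-max Q)

firstExponentsBelow-occurs : ∀ {n} {Q : Poly (suc n)} {M j t} → FirstExponentsBelow Q M → Occurs (j ∷ t) Q → j ℕ.< M
firstExponentsBelow-occurs (lt ∷ _) (here refl) = lt
firstExponentsBelow-occurs (_ ∷ below) (there occ) = firstExponentsBelow-occurs below occ

eval-slice-cons : ∀ {n} i j t c (Q : Poly (suc n)) xs →
  eval (slice i ((j ∷ t , c) ∷ Q)) xs ≡ single j (c * evalMono t xs) i + eval (slice i Q) xs
eval-slice-cons i j t c Q xs with j ℕ.≟ i
... | yes refl = cong (_+ eval (slice i Q) xs) (sym (single-self j _))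
... | no j≢i = sym (trans (cong (_+ eval (slice i Q) xs) (single-other j _ i (λ i≡j → j≢i (sym i≡j)))) (+-identityˡ _))

eval-slices : ∀ {n} (Q : Poly (suc n)) M x xs → FirstExponentsBelow Q M →
              eval Q (x ∷ xs) ≡ horner (coeffVec (λ i → eval (slice i Q) xs) M) (ℤtoℚ x)
eval-slices [] M x xs _ = sym (horner-coeffVec-0 _ M _ (λ _ → refl))
eval-slices ((j ∷ t , c) ∷ Q) M x xs (j<M ∷ below) = begin
  c * (powℚ y j * evalMono t xs) + eval Q (x ∷ xs)                  ≡⟨ cong (c * (powℚ y j * evalMono t xs) +_)
                                                                         (eval-slices Q M x xs below) ⟩
  c * (powℚ y j * evalMono t xs) + horner (coeffVec rest M) y       ≡⟨ cong (_+ horner (coeffVec rest M) y) (swap c (powℚ y j) (evalMono t xs)) ⟩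
  powℚ y j * (c * evalMono t xs) + horner (coeffVec rest M) y       ≡⟨ cong (_+ horner (coeffVec rest M) y)
                                                                         (horner-coeffVec-single j (c * evalMono t xs) M y j<M) ⟨
  horner (coeffVec (single j (c * evalMono t xs)) M) y + horner (coeffVec rest M) y
                                                                    ≡⟨ horner-coeffVec-+ _ _ M y ⟨
  horner (coeffVec (λ i → single j (c * evalMono t xs) i + rest i) M) y
                                                                    ≡⟨ horner-coeffVec-cong M y (λ i → sym (eval-slice-cons i j t c Q xs)) ⟩
  horner (coeffVec (λ i → eval (slice i ((j ∷ t , c) ∷ Q)) xs) M) y ∎
  where
  open ≡-Reasoning
  y = ℤtoℚ x
  rest = λ i → eval (slice i Q) xs
  swap : ∀ c p m → c * (p * m) ≡ p * (c * m)
  swap = solve-∀ ℚ-ring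

largest-satisfying : (P : ℕ → Set) → (∀ i → Dec (P i)) → ∀ M → (∃ λ j → j ℕ.< M × P j) →
                     ∃ λ k → k ℕ.< M × P k × (∀ i → k ℕ.< i → i ℕ.< M → ¬ P i)
largest-satisfying P P? zero (j , () , _)
largest-satisfying P P? (suc M) (j , j<1+M , Pj) with P? M
... | yes PM = M , ℕP.n<1+n M , PM , λ i M<i i<1+M → ⊥-elim (ℕP.<-irrefl refl (ℕP.<-≤-trans M<i (ℕP.≤-pred i<1+M)))
... | no ¬PM =
  let (k , k<M , Pk , above) = largest-satisfying P P? M (j , below-M j<1+M (λ { refl → ¬PM Pj }) , Pj)
  in k , ℕP.m≤n⇒m≤1+n k<M , Pk ,
     λ i k<i i<1+M → case-M i (λ { refl → ¬PM }) (λ i≢M → above i k<i (below-M i<1+M i≢M))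
  where
  below-M : ∀ {i} → i ℕ.< suc M → ¬ i ≡ M → i ℕ.< M
  below-M i<1+M i≢M = ℕP.≤∧≢⇒< (ℕP.≤-pred i<1+M) i≢M
  case-M : ∀ i → (i ≡ M → ¬ P i) → (¬ i ≡ M → ¬ P i) → ¬ P i
  case-M i yes-case no-case with i ℕ.≟ M
  ... | yes i≡M = yes-case i≡M
  ... | no i≢M = no-case i≢M

extendGrid : ∀ {n} → List ℤ → List (Vec ℤ n) → List (Vec ℤ (suc n))
extendGrid G [] = []
extendGrid G (xs ∷ XS) = map (_∷ xs) G ++ extendGrid G XS

grid : ∀ n → List ℤ → List (Vec ℤ n)
grid zero G = [] ∷ []
grid (suc n) G = extendGrid G (grid n G)

length-extendGrid : ∀ {n} G (XS : List (Vec ℤ n)) → length (extendGrid G XS) ≡ length G ℕ.* length XS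
length-extendGrid G [] = sym (ℕP.*-zeroʳ (length G))
length-extendGrid G (xs ∷ XS) = begin
  length (map (_∷ xs) G ++ extendGrid G XS)           ≡⟨ length-++ (map (_∷ xs) G) ⟩
  length (map (_∷ xs) G) ℕ.+ length (extendGrid G XS) ≡⟨ cong₂ ℕ._+_ (length-map _ G) (length-extendGrid G XS) ⟩
  length G ℕ.+ length G ℕ.* length XS                 ≡⟨ ℕP.*-suc (length G) (length XS) ⟨
  length G ℕ.* suc (length XS)                        ∎
  where open ≡-Reasoning

length-grid : ∀ n G → length (grid n G) ≡ length G ^ n
length-grid zero G = refl
length-grid (suc n) G = trans (length-extendGrid G (grid n G)) (cong (length G ℕ.*_) (length-grid n G))

isRootOf : ∀ {n} → Poly n → Vec ℤ n → Bool
isRootOf Q x = isZero (eval Q x)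

-- Roots of Q on G × XS: at most k above each non-root of S, and at most |G| above each root of S.
count-roots-extendGrid : ∀ {n} (Q : Poly (suc n)) (S : Poly n) k G →
  (∀ xs → isRootOf S xs ≡ false → count (λ y → isRootOf Q (y ∷ xs)) G ℕ.≤ k) →
  ∀ XS → count (isRootOf Q) (extendGrid G XS) ℕ.≤ k ℕ.* length XS ℕ.+ length G ℕ.* count (isRootOf S) XS
count-roots-extendGrid Q S k G fibre [] = ℕ.z≤n
count-roots-extendGrid Q S k G fibre (xs ∷ XS) = begin
  count (isRootOf Q) (map (_∷ xs) G ++ extendGrid G XS)          ≡⟨ count-++ (isRootOf Q) (map (_∷ xs) G) _ ⟩
  count (isRootOf Q) (map (_∷ xs) G) ℕ.+ count (isRootOf Q) (extendGrid G XS)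
                                                                  ≡⟨ cong (ℕ._+ count (isRootOf Q) (extendGrid G XS))
                                                                       (count-map (isRootOf Q) (_∷ xs) G) ⟩
  above-xs ℕ.+ count (isRootOf Q) (extendGrid G XS)               ≤⟨ ℕP.+-mono-≤ (fibre-bound (isRootOf S xs) refl)
                                                                       (count-roots-extendGrid Q S k G fibre XS) ⟩
  (k ℕ.+ indicator (isRootOf S xs)) ℕ.+ (k ℕ.* length XS ℕ.+ length G ℕ.* count (isRootOf S) XS)
                                                                  ≡⟨ arith (isRootOf S xs) ⟩
  k ℕ.* suc (length XS) ℕ.+ length G ℕ.* count (isRootOf S) (xs ∷ XS) ∎
  where
  open ℕP.≤-Reasoning
  above-xs = count (λ y → isRootOf Q (y ∷ xs)) G
  indicator : Bool → ℕ
  indicator true = length G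
  indicator false = 0
  fibre-bound : ∀ b → isRootOf S xs ≡ b → above-xs ℕ.≤ k ℕ.+ indicator b
  fibre-bound true _ = ℕP.m≤n⇒m≤o+n k (count-≤-length _ G)
  fibre-bound false S≢0 = ℕP.≤-trans (fibre xs S≢0) (ℕP.m≤m+n k 0)
  arith : ∀ b → (k ℕ.+ indicator b) ℕ.+ (k ℕ.* length XS ℕ.+ length G ℕ.* count (isRootOf S) XS)
              ≡ k ℕ.* suc (length XS) ℕ.+ length G ℕ.* (if b then suc (count (isRootOf S) XS) else count (isRootOf S) XS)
  arith true = identity k (length G) (length XS) (count (isRootOf S) XS)
    where identity : ∀ k N l c → (k ℕ.+ N) ℕ.+ (k ℕ.* l ℕ.+ N ℕ.* c) ≡ k ℕ.* suc l ℕ.+ N ℕ.* suc c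
          identity = ℕ-Solver.solve-∀
  arith false = identity k (length G) (length XS) (count (isRootOf S) XS)
    where identity : ∀ k N l c → (k ℕ.+ 0) ℕ.+ (k ℕ.* l ℕ.+ N ℕ.* c) ≡ k ℕ.* suc l ℕ.+ N ℕ.* c
          identity = ℕ-Solver.solve-∀

-- k is the degree of Q in its first variable
top-slice : ∀ {n} (Q : Poly (suc n)) → NonZeroPoly Q →
  ∃ λ k → NonZeroPoly (slice k Q) ×
          (∀ y xs → eval Q (y ∷ xs) ≡ horner (coeffVec (λ i → eval (slice i Q) xs) (suc k)) (ℤtoℚ y))
top-slice Q (j ∷ t , jt∈Q) =
  let (k , k<M , nz-k , above) = largest-satisfying (λ i → NonZeroPoly (slice i Q)) (λ i → nonZero? (slice i Q)) M
                                   (j , occurs-below j t jt∈Q' , t , jt∈Q')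
  in k , nz-k , λ y xs → trans (eval-slices Q M y xs below)
       (horner-coeffVec-truncate _ (suc k) M (ℤtoℚ y) k<M
         (λ i k<i → eval-identicallyZero (slice i Q) (¬nonZero⇒identicallyZero (slice i Q) (zero-above k above i k<i)) xs))
  where
  M = suc (maxFirstExponent Q)
  below = firstExponentsBelow-max Q
  monomial-slice : ∀ {i t} → IsMonomialOf t (slice i Q) → IsMonomialOf (i ∷ t) Q
  monomial-slice {i} {t} it∈Q z = it∈Q (trans (coeff-slice i Q t) z)
  jt∈Q' : IsMonomialOf t (slice j Q)
  jt∈Q' z = jt∈Q (trans (sym (coeff-slice j Q t)) z)
  occurs-below : ∀ i t → IsMonomialOf t (slice i Q) → i ℕ.< M
  occurs-below i t it∈Q = firstExponentsBelow-occurs below (monomial⇒occurs Q (monomial-slice it∈Q))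
  zero-above : ∀ k → (∀ i → k ℕ.< i → i ℕ.< M → ¬ NonZeroPoly (slice i Q)) → ∀ i → k ℕ.< i → ¬ NonZeroPoly (slice i Q)
  zero-above k above i k<i (t , it∈Q) = above i k<i (occurs-below i t it∈Q) (t , it∈Q)

degree-slice : ∀ {n} (Q : Poly (suc n)) {D} k → DegreeAtMost Q D → DegreeAtMost (slice k Q) (D ∸ k)
degree-slice Q {D} k deg t t∈Q = ℕP.m+n≤o⇒m≤o∸n (totalDeg t)
  (subst (ℕ._≤ D) (ℕP.+-comm k (totalDeg t)) (deg (k ∷ t) (λ z → t∈Q (trans (coeff-slice k Q t) z))))

nonZero-slice⇒≤degree : ∀ {n} (Q : Poly (suc n)) {D} k → DegreeAtMost Q D → NonZeroPoly (slice k Q) → k ℕ.≤ D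
nonZero-slice⇒≤degree Q k deg (t , t∈Q) =
  ℕP.m+n≤o⇒m≤o k (deg (k ∷ t) (λ z → t∈Q (trans (coeff-slice k Q t) z)))

schwartz-zippel : ∀ n G → Unique (map ℤtoℚ G) → ∀ (Q : Poly n) D → NonZeroPoly Q → DegreeAtMost Q D →
                  count (isRootOf Q) (grid n G) ℕ.* length G ℕ.≤ D ℕ.* length G ^ n
schwartz-zippel zero G _ Q D ([] , []∈Q) deg with eval Q [] ℚ.≟ 0ℚ
... | no _ = ℕ.z≤n
... | yes Q[]≡0 = ⊥-elim ([]∈Q (begin
  coeff Q []          ≡⟨ *-identityʳ (coeff Q []) ⟨
  coeff Q [] * 1ℚ     ≡⟨ eval-single Q [] (λ { [] []≢[] → ⊥-elim ([]≢[] refl) }) [] ⟨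
  eval Q []           ≡⟨ Q[]≡0 ⟩
  0ℚ                  ∎))
  where open ≡-Reasoning
schwartz-zippel (suc n) G unique Q D nz deg = begin
  count (isRootOf Q) (grid (suc n) G) ℕ.* N                 ≤⟨ ℕP.*-monoˡ-≤ N
                                                                 (count-roots-extendGrid Q (slice k Q) k G fibre (grid n G)) ⟩
  (k ℕ.* length (grid n G) ℕ.+ N ℕ.* c) ℕ.* N               ≡⟨ cong (λ l → (k ℕ.* l ℕ.+ N ℕ.* c) ℕ.* N) (length-grid n G) ⟩
  (k ℕ.* N ^ n ℕ.+ N ℕ.* c) ℕ.* N                           ≡⟨ distrib k (N ^ n) N c ⟩
  k ℕ.* N ^ n ℕ.* N ℕ.+ N ℕ.* (c ℕ.* N)                     ≤⟨ ℕP.+-monoʳ-≤ (k ℕ.* N ^ n ℕ.* N) (ℕP.*-monoʳ-≤ N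
                                                                 (schwartz-zippel n G unique (slice k Q) (D ∸ k) nz-k (degree-slice Q k deg))) ⟩
  k ℕ.* N ^ n ℕ.* N ℕ.+ N ℕ.* ((D ∸ k) ℕ.* N ^ n)           ≡⟨ collect k (D ∸ k) N (N ^ n) ⟩
  (k ℕ.+ (D ∸ k)) ℕ.* (N ℕ.* N ^ n)                         ≡⟨ cong (ℕ._* (N ℕ.* N ^ n)) (ℕP.m+[n∸m]≡n k≤D) ⟩
  D ℕ.* N ^ suc n                                           ∎
  where
  open ℕP.≤-Reasoning
  N = length G
  k = proj₁ (top-slice Q nz)
  nz-k = proj₁ (proj₂ (top-slice Q nz))
  c = count (isRootOf (slice k Q)) (grid n G)
  k≤D = nonZero-slice⇒≤degree Q k deg nz-k
  -- over a non-root xs of the top slice, y ↦ Q (y, xs) is univariate of degree k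
  fibre : ∀ xs → isRootOf (slice k Q) xs ≡ false → count (λ y → isRootOf Q (y ∷ xs)) G ℕ.≤ k
  fibre xs nonroot = ℕP.≤-trans
    (ℕP.≤-reflexive (trans (count-cong (λ y → cong isZero (proj₂ (proj₂ (top-slice Q nz)) y xs)) G)
                           (sym (count-map (λ y → isZero (horner (coeffVec f (suc k)) y)) ℤtoℚ G))))
    (roots≤degree k (coeffVec f (suc k)) lead≢0 (map ℤtoℚ G) unique)
    where
    f = λ i → eval (slice i Q) xs
    lead≢0 : ¬ leadingCoeff (coeffVec f (suc k)) ≡ 0ℚ
    lead≢0 z = isZero-false nonroot (trans (sym (leadingCoeff-coeffVec f k)) z)
  distrib : ∀ k P N c → (k ℕ.* P ℕ.+ N ℕ.* c) ℕ.* N ≡ k ℕ.* P ℕ.* N ℕ.+ N ℕ.* (c ℕ.* N)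
  distrib = ℕ-Solver.solve-∀
  collect : ∀ k d N P → k ℕ.* P ℕ.* N ℕ.+ N ℕ.* (d ℕ.* P) ≡ (k ℕ.+ d) ℕ.* (N ℕ.* P)
  collect = ℕ-Solver.solve-∀

⌊n/2⌋<a : ∀ n a → n ℕ.< 2 ℕ.* a → ⌊ n /2⌋ ℕ.< a
⌊n/2⌋<a n a n<2a = ℕP.*-cancelˡ-< 2 ⌊ n /2⌋ a (ℕP.≤-<-trans twice-half≤n n<2a)
  where
  open ℕP.≤-Reasoning
  twice-half≤n : 2 ℕ.* ⌊ n /2⌋ ℕ.≤ n
  twice-half≤n = begin
    ⌊ n /2⌋ ℕ.+ (⌊ n /2⌋ ℕ.+ 0)   ≡⟨ cong (⌊ n /2⌋ ℕ.+_) (ℕP.+-identityʳ ⌊ n /2⌋) ⟩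
    ⌊ n /2⌋ ℕ.+ ⌊ n /2⌋           ≤⟨ ℕP.+-monoʳ-≤ ⌊ n /2⌋ (ℕP.⌊n/2⌋≤⌈n/2⌉ n) ⟩
    ⌊ n /2⌋ ℕ.+ ⌈ n /2⌉           ≡⟨ ℕP.⌊n/2⌋+⌈n/2⌉≡n n ⟩
    n                             ∎

bitLength-< : ∀ s y → y ℕ.< 2 ^ s → bitLength y ℕ.≤ s
bitLength-< s zero _ = ℕ.z≤n
bitLength-< zero (suc m) (ℕ.s≤s ())
bitLength-< (suc s) 1 _ = ℕ.s≤s ℕ.z≤n
bitLength-< (suc s) y@(suc (suc m)) y<2^s+1 = ℕ.s≤s (begin
  ⌊log₂ y ⌋                   ≤⟨ ℕP.m≤n+m∸n ⌊log₂ y ⌋ 1 ⟩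
  1 ℕ.+ (⌊log₂ y ⌋ ∸ 1)       ≡⟨ cong suc (⌊log₂⌊n/2⌋⌋≡⌊log₂n⌋∸1 y) ⟨
  bitLength ⌊ y /2⌋           ≤⟨ bitLength-< s ⌊ y /2⌋ (⌊n/2⌋<a y (2 ^ s) y<2^s+1) ⟩
  s                           ∎)
  where open ℕP.≤-Reasoning

n≤2^⌈log₂n⌉ : ∀ n → n ℕ.≤ 2 ^ ⌈log₂ n ⌉
n≤2^⌈log₂n⌉ n = go n n ℕP.≤-refl
  where
  -- induction on an upper bound f for n, which halving n decreases
  go : ∀ f n → n ℕ.≤ f → n ℕ.≤ 2 ^ ⌈log₂ n ⌉
  go f zero _ = ℕ.z≤n
  go f 1 _ = ℕ.s≤s ℕ.z≤n
  go (suc f) m@(suc (suc n)) (ℕ.s≤s m≤1+f) = begin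
    m                                 ≡⟨ ℕP.⌊n/2⌋+⌈n/2⌉≡n m ⟨
    ⌊ m /2⌋ ℕ.+ ⌈ m /2⌉               ≤⟨ ℕP.+-monoˡ-≤ ⌈ m /2⌉ (ℕP.⌊n/2⌋≤⌈n/2⌉ m) ⟩
    ⌈ m /2⌉ ℕ.+ ⌈ m /2⌉               ≤⟨ ℕP.+-mono-≤ half≤ half≤ ⟩
    2 ^ (L ∸ 1) ℕ.+ 2 ^ (L ∸ 1)       ≡⟨ cong (2 ^ (L ∸ 1) ℕ.+_) (ℕP.+-identityʳ (2 ^ (L ∸ 1))) ⟨
    2 ^ suc (L ∸ 1)                   ≡⟨ cong (2 ^_) (ℕP.m+[n∸m]≡n 1≤L) ⟩
    2 ^ L                             ∎
    where
    open ℕP.≤-Reasoning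
    L = ⌈log₂ m ⌉
    1≤L : 1 ℕ.≤ L
    1≤L = ⌈log₂⌉-mono-≤ {2} {m} (ℕ.s≤s (ℕ.s≤s ℕ.z≤n))
    half≤ : ⌈ m /2⌉ ℕ.≤ 2 ^ (L ∸ 1)
    half≤ = subst (λ z → ⌈ m /2⌉ ℕ.≤ 2 ^ z) (⌈log₂⌈n/2⌉⌉≡⌈log₂n⌉∸1 m)
              (go f ⌈ m /2⌉ (ℕP.≤-trans (ℕ.s≤s (ℕP.≤-pred (ℕP.⌊n/2⌋<n n))) m≤1+f))

infixl 1 _>>=_
_>>=_ : ∀ {n A B} → Alg n A → (A → Alg n B) → Alg n B
ret o >>= f = f o
flip k >>= f = flip (λ b → k b >>= f)
query x k >>= f = query x (λ v → k v >>= f)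

module _ {n : ℕ} {A : Set} (O : Vec ℤ n → ℚ) where

  Prob-nonNeg : ∀ (S : A → Bool) X → 0ℚ ≤ Prob O S X
  Prob-nonNeg S (ret o) with S o
  ... | true = 0≤1
  ... | false = ≤-refl
  Prob-nonNeg S (flip k) = half-avg 0ℚ _ _ (Prob-nonNeg S (k false)) (Prob-nonNeg S (k true))
  Prob-nonNeg S (query x k) = Prob-nonNeg S (k (O x))

  Prob-ret : ∀ (S : A → Bool) o → S o ≡ true → Prob O S (ret o) ≡ 1ℚ
  Prob-ret S o So with S o
  ... | true = refl

  queriesBounded-mono : ∀ {q q'} s → q ℕ.≤ q' → ∀ (X : Alg n A) → QueriesBounded O q s X → QueriesBounded O q' s X
  queriesBounded-mono s q≤q' (ret _) _ = tt
  queriesBounded-mono s q≤q' (flip k) (bf , bt) =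
    queriesBounded-mono s q≤q' (k false) bf , queriesBounded-mono s q≤q' (k true) bt
  queriesBounded-mono {suc q} {suc q'} s (ℕ.s≤s q≤q') (query x k) (sizes , rest) =
    sizes , queriesBounded-mono s q≤q' (k (O x)) rest

Returns : ∀ {n A} → (Vec ℤ n → ℚ) → Alg n A → A → Set
Returns O (ret a) o = a ≡ o
Returns O (flip k) o = ⊥
Returns O (query x k) o = Returns O (k (O x)) o

module _ {n : ℕ} {A B : Set} (O : Vec ℤ n → ℚ) where

  Prob->>= : ∀ (G : A → Bool) (S : B → Bool) m (f : A → Alg n B) → 0ℚ ≤ m →
             (∀ o → G o ≡ true → m ≤ Prob O S (f o)) → ∀ X → m * Prob O G X ≤ Prob O S (X >>= f)
  Prob->>= G S m f 0≤m good (ret o) with G o in Go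
  ... | true = ≤-trans (≤-reflexive (*-identityʳ m)) (good o Go)
  ... | false = ≤-trans (≤-reflexive (*-zeroʳ m)) (Prob-nonNeg O S (f o))
  Prob->>= G S m f 0≤m good (flip k) =
    ≤-trans (≤-reflexive (distrib m _ _))
            (*-monoˡ-≤-nonNeg ½ (+-mono-≤ (Prob->>= G S m f 0≤m good (k false)) (Prob->>= G S m f 0≤m good (k true))))
    where distrib : ∀ m a b → m * (½ * (a + b)) ≡ ½ * (m * a + m * b)
          distrib = solve-∀ ℚ-ring
  Prob->>= G S m f 0≤m good (query x k) = Prob->>= G S m f 0≤m good (k (O x))

  Prob->>=-deterministic : ∀ (S : B → Bool) (X : Alg n A) o (f : A → Alg n B) →
    Returns O X o → Prob O S (X >>= f) ≡ Prob O S (f o)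
  Prob->>=-deterministic S (ret a) o f refl = refl
  Prob->>=-deterministic S (query x k) o f r = Prob->>=-deterministic S (k (O x)) o f r

  queriesBounded->>= : ∀ q₁ q₂ s (X : Alg n A) (f : A → Alg n B) → QueriesBounded O q₁ s X →
                       (∀ o → QueriesBounded O q₂ s (f o)) → QueriesBounded O (q₁ ℕ.+ q₂) s (X >>= f)
  queriesBounded->>= q₁ q₂ s (ret o) f _ bf = queriesBounded-mono O s (ℕP.m≤n+m q₂ q₁) (f o) (bf o)
  queriesBounded->>= q₁ q₂ s (flip k) f (bf , bt) b =
    queriesBounded->>= q₁ q₂ s (k false) f bf b , queriesBounded->>= q₁ q₂ s (k true) f bt b
  queriesBounded->>= (suc q₁) q₂ s (query x k) f (sizes , rest) b = sizes , queriesBounded->>= q₁ q₂ s (k (O x)) f rest b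

-- Uniform sampling from [0, 2^s) by s coin flips

uniform : ∀ {n A} → ℕ → (ℕ → Alg n A) → Alg n A
uniform zero k = k 0
uniform (suc s) k = flip (λ b → uniform s (λ y → k (if b then 2 ^ s ℕ.+ y else y)))

uniformVec : ∀ {n A} → ℕ → ∀ m → (Vec ℤ m → Alg n A) → Alg n A
uniformVec s zero k = k []
uniformVec s (suc m) k = uniformVec s m (λ xs → uniform s (λ y → k (ℤ.+ y ∷ xs)))

-- the values of [0, 2^s), in the order in which uniform s reaches them
uniformValues : ℕ → List ℕ
uniformValues zero = 0 ∷ []
uniformValues (suc s) = uniformValues s ++ map (2 ^ s ℕ.+_) (uniformValues s)

uniformPoints : ℕ → List ℤ
uniformPoints s = map ℤ.+_ (uniformValues s)

length-uniformValues : ∀ s → length (uniformValues s) ≡ 2 ^ s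
length-uniformValues zero = refl
length-uniformValues (suc s) = begin
  length (uniformValues s ++ map (2 ^ s ℕ.+_) (uniformValues s))        ≡⟨ length-++ (uniformValues s) ⟩
  length (uniformValues s) ℕ.+ length (map (2 ^ s ℕ.+_) (uniformValues s)) ≡⟨ cong (length (uniformValues s) ℕ.+_)
                                                                               (length-map _ (uniformValues s)) ⟩
  length (uniformValues s) ℕ.+ length (uniformValues s)                 ≡⟨ cong₂ ℕ._+_ (length-uniformValues s) (length-uniformValues s) ⟩
  2 ^ s ℕ.+ 2 ^ s                                                       ≡⟨ cong (2 ^ s ℕ.+_) (ℕP.+-identityʳ (2 ^ s)) ⟨
  2 ^ suc s                                                             ∎
  where open ≡-Reasoning

length-uniformPoints : ∀ s → length (uniformPoints s) ≡ 2 ^ s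
length-uniformPoints s = trans (length-map ℤ.+_ (uniformValues s)) (length-uniformValues s)

uniformValues-< : ∀ s → All (ℕ._< 2 ^ s) (uniformValues s)
uniformValues-< zero = ℕ.s≤s ℕ.z≤n ∷ []
uniformValues-< (suc s) = All.++⁺
  (All.map (λ y<2^s → ℕP.<-≤-trans y<2^s (ℕP.m≤m+n (2 ^ s) _)) (uniformValues-< s))
  (All.map⁺ (All.map (λ {y} y<2^s → subst (2 ^ s ℕ.+ y ℕ.<_) (cong (2 ^ s ℕ.+_) (sym (ℕP.+-identityʳ (2 ^ s))))
                                       (ℕP.+-monoʳ-< (2 ^ s) y<2^s)) (uniformValues-< s)))

uniformValues-unique : ∀ s → Unique (uniformValues s)
uniformValues-unique zero = [] ∷ []
uniformValues-unique (suc s) = Unique.++⁺ (uniformValues-unique s)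
  (Unique.map⁺ (ℕP.+-cancelˡ-≡ (2 ^ s) _ _) (uniformValues-unique s))
  (λ (y∈low , y∈high) → let (z , _ , y≡2^s+z) = ∈-map⁻ (2 ^ s ℕ.+_) y∈high in
     ℕP.<⇒≱ (All.lookup (uniformValues-< s) y∈low) (ℕP.≤-trans (ℕP.m≤m+n (2 ^ s) z) (ℕP.≤-reflexive (sym y≡2^s+z))))

uniformPoints-unique : ∀ s → Unique (map ℤtoℚ (uniformPoints s))
uniformPoints-unique s = subst Unique (map-∘ (uniformValues s))
  (Unique.map⁺ (λ eq → ℤP.+-injective (ℤtoℚ-injective eq)) (uniformValues-unique s))
  where
  ℤtoℚ-injective : ∀ {a b} → ℤtoℚ a ≡ ℤtoℚ b → a ≡ b
  ℤtoℚ-injective {a} {b} eq = begin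
    a                    ≡⟨ numerator a ⟨
    ℚ.↥ (ℤtoℚ a)         ≡⟨ cong ℚ.↥_ eq ⟩
    ℚ.↥ (ℤtoℚ b)         ≡⟨ numerator b ⟩
    b                    ∎
    where
    open ≡-Reasoning
    numerator : ∀ z → ℚ.↥ (ℤtoℚ z) ≡ z
    numerator z = begin
      ℚ.↥ (ℤtoℚ z)                         ≡⟨ ℤP.*-identityʳ _ ⟨
      ℚ.↥ (ℤtoℚ z) ℤ.* ℤ.+ 1               ≡⟨ cong (ℚ.↥ (ℤtoℚ z) ℤ.*_) (gcd-zeroʳ z) ⟨
      ℚ.↥ (ℤtoℚ z) ℤ.* gcd z (ℤ.+ 1)       ≡⟨ ↥-/ z 1 ⟩
      z                                    ∎

sumℚ : {A : Set} → (A → ℚ) → List A → ℚ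
sumℚ f [] = 0ℚ
sumℚ f (x ∷ L) = f x + sumℚ f L

sumℚ-++ : {A : Set} (f : A → ℚ) (X Y : List A) → sumℚ f (X ++ Y) ≡ sumℚ f X + sumℚ f Y
sumℚ-++ f [] Y = sym (+-identityˡ _)
sumℚ-++ f (x ∷ X) Y = trans (cong (f x +_) (sumℚ-++ f X Y)) (sym (+-assoc (f x) _ _))

sumℚ-map : {A B : Set} (f : B → ℚ) (g : A → B) (L : List A) → sumℚ f (map g L) ≡ sumℚ (λ x → f (g x)) L
sumℚ-map f g [] = refl
sumℚ-map f g (x ∷ L) = cong (f (g x) +_) (sumℚ-map f g L)

sumℚ-cong : {A : Set} {f g : A → ℚ} → (∀ x → f x ≡ g x) → ∀ L → sumℚ f L ≡ sumℚ g L
sumℚ-cong f≗g [] = refl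
sumℚ-cong f≗g (x ∷ L) = cong₂ _+_ (f≗g x) (sumℚ-cong f≗g L)

sumℚ-*ʳ : {A : Set} (f : A → ℚ) (c : ℚ) (L : List A) → sumℚ f L * c ≡ sumℚ (λ x → f x * c) L
sumℚ-*ʳ f c [] = *-zeroˡ c
sumℚ-*ʳ f c (x ∷ L) = trans (*-distribʳ-+ c (f x) (sumℚ f L)) (cong (f x * c +_) (sumℚ-*ʳ f c L))

sumℚ-extendGrid : ∀ {m} (g : Vec ℤ (suc m) → ℚ) G (XS : List (Vec ℤ m)) →
                  sumℚ g (extendGrid G XS) ≡ sumℚ (λ xs → sumℚ (λ y → g (y ∷ xs)) G) XS
sumℚ-extendGrid g G [] = refl
sumℚ-extendGrid g G (xs ∷ XS) = trans (sumℚ-++ g (map (_∷ xs) G) (extendGrid G XS))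
  (cong₂ _+_ (sumℚ-map g (_∷ xs) G) (sumℚ-extendGrid g G XS))

sumℚ-lowerBound : {A : Set} (f : A → ℚ) (bad : A → Bool) (d : ℚ) (L : List A) →
  (∀ x → bad x ≡ false → 1ℚ ≤ f x) → (∀ x → bad x ≡ true → 1ℚ - d ≤ f x) →
  fromℕ (length L) - fromℕ (count bad L) * d ≤ sumℚ f L
sumℚ-lowerBound f bad d [] good fair = ≤-reflexive (cong (λ z → 0ℚ - z) (*-zeroˡ d))
sumℚ-lowerBound f bad d (x ∷ L) good fair with bad x in bx
... | true = ≤-trans (≤-reflexive (regroup (fromℕ (length L)) (fromℕ (count bad L)) d))
                     (+-mono-≤ (fair x bx) (sumℚ-lowerBound f bad d L good fair))
  where regroup : ∀ l c d → (1ℚ + l) - (1ℚ + c) * d ≡ (1ℚ - d) + (l - c * d)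
        regroup = solve-∀ ℚ-ring
... | false = ≤-trans (≤-reflexive (regroup (fromℕ (length L)) (fromℕ (count bad L)) d))
                      (+-mono-≤ (good x bx) (sumℚ-lowerBound f bad d L good fair))
  where regroup : ∀ l c d → (1ℚ + l) - c * d ≡ 1ℚ + (l - c * d)
        regroup = solve-∀ ℚ-ring

module _ {n : ℕ} {A : Set} (O : Vec ℤ n → ℚ) (S : A → Bool) where

  Prob-uniform : ∀ s (k : ℕ → Alg n A) →
                 Prob O S (uniform s k) * powℚ (fromℕ 2) s ≡ sumℚ (λ y → Prob O S (k y)) (uniformValues s)
  Prob-uniform zero k = trans (*-identityʳ (Prob O S (k 0))) (sym (+-identityʳ (Prob O S (k 0))))
  Prob-uniform (suc s) k = begin
    ½ * (Prob O S (uniform s k) + Prob O S (uniform s k')) * (fromℕ 2 * powℚ (fromℕ 2) s)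
      ≡⟨ regroup (Prob O S (uniform s k)) (Prob O S (uniform s k')) (powℚ (fromℕ 2) s) ⟩
    Prob O S (uniform s k) * powℚ (fromℕ 2) s + Prob O S (uniform s k') * powℚ (fromℕ 2) s
      ≡⟨ cong₂ _+_ (Prob-uniform s k) (trans (Prob-uniform s k') (sym (sumℚ-map (λ y → Prob O S (k y)) (2 ^ s ℕ.+_) (uniformValues s)))) ⟩
    sumℚ (λ y → Prob O S (k y)) (uniformValues s) + sumℚ (λ y → Prob O S (k y)) (map (2 ^ s ℕ.+_) (uniformValues s))
      ≡⟨ sumℚ-++ (λ y → Prob O S (k y)) (uniformValues s) _ ⟨
    sumℚ (λ y → Prob O S (k y)) (uniformValues (suc s))
      ∎
    where
    open ≡-Reasoning
    k' = λ y → k (2 ^ s ℕ.+ y)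
    regroup : ∀ a b T → ½ * (a + b) * (fromℕ 2 * T) ≡ a * T + b * T
    regroup = solve-∀ ℚ-ring

  Prob-uniformVec : ∀ s m (k : Vec ℤ m → Alg n A) →
    Prob O S (uniformVec s m k) * powℚ (powℚ (fromℕ 2) s) m ≡ sumℚ (λ x → Prob O S (k x)) (grid m (uniformPoints s))
  Prob-uniformVec s zero k = trans (*-identityʳ (Prob O S (k []))) (sym (+-identityʳ (Prob O S (k []))))
  Prob-uniformVec s (suc m) k = begin
    Prob O S (uniformVec s m k') * (T * powℚ T m)        ≡⟨ regroup (Prob O S (uniformVec s m k')) T (powℚ T m) ⟩
    Prob O S (uniformVec s m k') * powℚ T m * T          ≡⟨ cong (_* T) (Prob-uniformVec s m k') ⟩
    sumℚ (λ xs → Prob O S (k' xs)) (grid m G) * T        ≡⟨ sumℚ-*ʳ _ T (grid m G) ⟩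
    sumℚ (λ xs → Prob O S (k' xs) * T) (grid m G)        ≡⟨ sumℚ-cong (λ xs → trans (Prob-uniform s (λ y → k (ℤ.+ y ∷ xs)))
                                                              (sym (sumℚ-map (λ y → Prob O S (k (y ∷ xs))) ℤ.+_ (uniformValues s)))) (grid m G) ⟩
    sumℚ (λ xs → sumℚ (λ y → Prob O S (k (y ∷ xs))) G) (grid m G)
                                                         ≡⟨ sumℚ-extendGrid (λ x → Prob O S (k x)) G (grid m G) ⟨
    sumℚ (λ x → Prob O S (k x)) (grid (suc m) G)         ∎
    where
    open ≡-Reasoning
    T = powℚ (fromℕ 2) s
    G = uniformPoints s
    k' = λ xs → uniform s (λ y → k (ℤ.+ y ∷ xs))
    regroup : ∀ p t u → p * (t * u) ≡ p * u * t
    regroup = solve-∀ ℚ-ring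

  Prob-uniform-≥ : ∀ s m (k : ℕ → Alg n A) → (∀ y → m ≤ Prob O S (k y)) → m ≤ Prob O S (uniform s k)
  Prob-uniform-≥ zero m k all-≥ = all-≥ 0
  Prob-uniform-≥ (suc s) m k all-≥ =
    half-avg m _ _ (Prob-uniform-≥ s m _ (λ y → all-≥ y)) (Prob-uniform-≥ s m _ (λ y → all-≥ _))

  Prob-uniformVec-≥ : ∀ s m' m (k : Vec ℤ m' → Alg n A) → (∀ x → m ≤ Prob O S (k x)) → m ≤ Prob O S (uniformVec s m' k)
  Prob-uniformVec-≥ s zero m k all-≥ = all-≥ []
  Prob-uniformVec-≥ s (suc m') m k all-≥ = Prob-uniformVec-≥ s m' m _ (λ xs → Prob-uniform-≥ s m _ (λ y → all-≥ _))

module _ {n : ℕ} {A : Set} (O : Vec ℤ n → ℚ) where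

  queriesBounded-uniform : ∀ q s s' (k : ℕ → Alg n A) → (∀ y → y ℕ.< 2 ^ s → QueriesBounded O q s' (k y)) →
                           QueriesBounded O q s' (uniform s k)
  queriesBounded-uniform q zero s' k bounded = bounded 0 (ℕ.s≤s ℕ.z≤n)
  queriesBounded-uniform q (suc s) s' k bounded =
    queriesBounded-uniform q s s' _ (λ y y<2^s → bounded y (ℕP.<-≤-trans y<2^s (ℕP.m≤m+n (2 ^ s) _))) ,
    queriesBounded-uniform q s s' _ (λ y y<2^s → bounded (2 ^ s ℕ.+ y)
      (subst (2 ^ s ℕ.+ y ℕ.<_) (cong (2 ^ s ℕ.+_) (sym (ℕP.+-identityʳ (2 ^ s)))) (ℕP.+-monoʳ-< (2 ^ s) y<2^s)))

  queriesBounded-uniformVec : ∀ q s m (k : Vec ℤ m → Alg n A) →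
    (∀ x → (∀ i → sizeℤ (lookup x i) ℕ.≤ s) → QueriesBounded O q s (k x)) → QueriesBounded O q s (uniformVec s m k)
  queriesBounded-uniformVec q s zero k bounded = bounded [] (λ ())
  queriesBounded-uniformVec q s (suc m) k bounded =
    queriesBounded-uniformVec q s m _ λ xs xs-small → queriesBounded-uniform q s s _ λ y y<2^s →
      bounded (ℤ.+ y ∷ xs) λ { Fin.zero → bitLength-< s y y<2^s ; (Fin.suc i) → xs-small i }

-- Testing whether a restriction of P is nonzero

zeroOutside-sizes : ∀ {n s} (T : Vec Bool n) y → (∀ i → sizeℤ (lookup y i) ℕ.≤ s) →
                    ∀ i → sizeℤ (lookup (zeroOutside T y) i) ℕ.≤ s
zeroOutside-sizes (true ∷ T) (y ∷ ys) small Fin.zero = small Fin.zero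
zeroOutside-sizes (false ∷ T) (y ∷ ys) small Fin.zero = ℕ.z≤n
zeroOutside-sizes (true ∷ T) (y ∷ ys) small (Fin.suc i) = zeroOutside-sizes T ys (λ j → small (Fin.suc j)) i
zeroOutside-sizes (false ∷ T) (y ∷ ys) small (Fin.suc i) = zeroOutside-sizes T ys (λ j → small (Fin.suc j)) i

probe : ∀ {n} → Vec Bool n → Vec ℤ n → Alg n Bool → Alg n Bool
probe T x otherwise = query (zeroOutside T x) (λ v → if isZero v then otherwise else ret true)

nonZeroTest : ∀ {n} → ℕ → Vec Bool n → ℕ → Alg n Bool
nonZeroTest s T zero = ret false
nonZeroTest {n} s T (suc r) = uniformVec s n (λ x → probe T x (nonZeroTest s T r))

nonZeroTest-identicallyZero : ∀ {n} (P : Poly n) s T r → IdenticallyZero (restrict T P) →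
                              1ℚ ≤ Prob (eval P) not (nonZeroTest s T r)
nonZeroTest-identicallyZero P s T zero _ = ≤-refl
nonZeroTest-identicallyZero {n} P s T (suc r) T-zero = Prob-uniformVec-≥ (eval P) not s n 1ℚ _ always-zero
  where
  always-zero : ∀ x → 1ℚ ≤ Prob (eval P) not (probe T x (nonZeroTest s T r))
  always-zero x with isZero (eval P (zeroOutside T x)) in Px
  ... | true = nonZeroTest-identicallyZero P s T r T-zero
  ... | false = ⊥-elim (isZero-false Px (trans (eval-zeroOutside T P x) (eval-identicallyZero (restrict T P) T-zero x)))

queriesBounded-nonZeroTest : ∀ {n} (P : Poly n) s T r → QueriesBounded (eval P) r s (nonZeroTest s T r)
queriesBounded-nonZeroTest P s T zero = tt
queriesBounded-nonZeroTest {n} P s T (suc r) = queriesBounded-uniformVec (eval P) (suc r) s n _ λ x x-small →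
  zeroOutside-sizes T x x-small , continue (eval P (zeroOutside T x))
  where
  continue : ∀ v → QueriesBounded (eval P) r s (if isZero v then nonZeroTest s T r else ret true)
  continue v with isZero v
  ... | true = queriesBounded-nonZeroTest P s T r
  ... | false = tt

K*N≤D*P⇒K*2≤P : ∀ K N D P → 0 ℕ.< N → K ℕ.* N ℕ.≤ D ℕ.* P → 2 ℕ.* D ℕ.≤ N → K ℕ.* 2 ℕ.≤ P
K*N≤D*P⇒K*2≤P zero N D P _ _ _ = ℕ.z≤n
K*N≤D*P⇒K*2≤P (suc K) (suc N) zero P _ () _
K*N≤D*P⇒K*2≤P (suc K) N (suc D) P _ KN≤DP 2D≤N = ℕP.*-cancelʳ-≤ (suc K ℕ.* 2) P (suc D) (begin
  suc K ℕ.* 2 ℕ.* suc D     ≡⟨ ℕP.*-assoc (suc K) 2 (suc D) ⟩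
  suc K ℕ.* (2 ℕ.* suc D)   ≤⟨ ℕP.*-monoʳ-≤ (suc K) 2D≤N ⟩
  suc K ℕ.* N               ≤⟨ KN≤DP ⟩
  suc D ℕ.* P               ≡⟨ ℕP.*-comm (suc D) P ⟩
  P ℕ.* suc D               ∎)
  where open ℕP.≤-Reasoning

roots-at-most-half : ∀ {n} (Q : Poly n) D s → NonZeroPoly Q → DegreeAtMost Q D → 2 ℕ.* D ℕ.≤ 2 ^ s →
                     count (isRootOf Q) (grid n (uniformPoints s)) ℕ.* 2 ℕ.≤ (2 ^ s) ^ n
roots-at-most-half {n} Q D s nz deg 2D≤2^s =
  K*N≤D*P⇒K*2≤P (count (isRootOf Q) (grid n (uniformPoints s))) (2 ^ s) D ((2 ^ s) ^ n) (ℕP.m^n>0 2 s)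
  (subst (λ N → count (isRootOf Q) (grid n (uniformPoints s)) ℕ.* N ℕ.≤ D ℕ.* N ^ n) (length-uniformPoints s)
         (schwartz-zippel n (uniformPoints s) (uniformPoints-unique s) Q D nz deg))
  2D≤2^s

nonZeroTest-nonZero : ∀ {n} (P : Poly n) s T D r → NonZeroPoly (restrict T P) → DegreeAtMost (restrict T P) D →
                      2 ℕ.* D ℕ.≤ 2 ^ s → 1ℚ - powℚ ½ r ≤ Prob (eval P) id (nonZeroTest s T r)
nonZeroTest-nonZero P s T D zero nz deg 2D≤2^s = ≤-reflexive (+-inverseʳ 1ℚ)
nonZeroTest-nonZero {n} P s T D (suc r) nz deg 2D≤2^s = *-cancelʳ-≤-pos M {{ℚ.positive M>0}} (begin
  (1ℚ - powℚ ½ (suc r)) * M                      ≡⟨ distrib (powℚ ½ (suc r)) M ⟩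
  M - M * powℚ ½ (suc r)                         ≤⟨ +-monoʳ-≤ M (neg-antimono-≤ roots-weight) ⟩
  M - fromℕ K * powℚ ½ r                         ≡⟨ cong (λ z → z - fromℕ K * powℚ ½ r) size-G ⟨
  fromℕ (length G) - fromℕ K * powℚ ½ r          ≤⟨ sumℚ-lowerBound (λ x → Prob (eval P) id (round x)) (isRootOf Q) (powℚ ½ r) G
                                                      nonroot root ⟩
  sumℚ (λ x → Prob (eval P) id (round x)) G      ≡⟨ Prob-uniformVec (eval P) id s n round ⟨
  Prob (eval P) id (nonZeroTest s T (suc r)) * M ∎)
  where
  open ≤-Reasoning
  Q = restrict T P
  G = grid n (uniformPoints s)
  M = powℚ (powℚ (fromℕ 2) s) n
  K = count (isRootOf Q) G
  round = λ x → probe T x (nonZeroTest s T r)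
  distrib : ∀ h M → (1ℚ - h) * M ≡ M - M * h
  distrib = solve-∀ ℚ-ring
  size-G : fromℕ (length G) ≡ M
  size-G = begin-equality
    fromℕ (length G)                  ≡⟨ cong fromℕ (trans (length-grid n (uniformPoints s)) (cong (_^ n) (length-uniformPoints s))) ⟩
    fromℕ ((2 ^ s) ^ n)               ≡⟨ fromℕ-^ (2 ^ s) n ⟩
    powℚ (fromℕ (2 ^ s)) n            ≡⟨ cong (λ z → powℚ z n) (fromℕ-^ 2 s) ⟩
    M                                 ∎
  M>0 : 0ℚ < M
  M>0 = subst (0ℚ <_) size-G (positive (length G) (subst (0 ℕ.<_) (sym (trans (length-grid n (uniformPoints s))
          (cong (_^ n) (length-uniformPoints s)))) (ℕP.m^n>0 (2 ^ s) {{ℕ.>-nonZero (ℕP.m^n>0 2 s)}} n)))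
    where positive : ∀ L → 0 ℕ.< L → 0ℚ < fromℕ L
          positive (suc L) _ = fromℕ-pos L
  roots-weight : fromℕ K * powℚ ½ r ≤ M * powℚ ½ (suc r)
  roots-weight = begin
    fromℕ K * powℚ ½ r                        ≡⟨ regroup (fromℕ K) (powℚ ½ r) ⟩
    fromℕ K * fromℕ 2 * powℚ ½ (suc r)        ≡⟨ cong (_* powℚ ½ (suc r)) (fromℕ-* K 2) ⟨
    fromℕ (K ℕ.* 2) * powℚ ½ (suc r)          ≤⟨ *-monoʳ-≤-nonNeg (powℚ ½ (suc r)) {{ℚ.nonNegative (powℚ-nonNeg (suc r) 0≤½)}}
                                                   (fromℕ-mono-≤ (roots-at-most-half Q D s nz deg 2D≤2^s)) ⟩
    fromℕ ((2 ^ s) ^ n) * powℚ ½ (suc r)      ≡⟨ cong (_* powℚ ½ (suc r)) (trans (fromℕ-^ (2 ^ s) n)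
                                                   (cong (λ z → powℚ z n) (fromℕ-^ 2 s))) ⟩
    M * powℚ ½ (suc r)                        ∎
    where
    regroup : ∀ k p → k * p ≡ k * fromℕ 2 * (½ * p)
    regroup = solve-∀ ℚ-ring
  nonroot : ∀ x → isRootOf Q x ≡ false → 1ℚ ≤ Prob (eval P) id (round x)
  nonroot x Qx≢0 with isZero (eval P (zeroOutside T x)) in Px
  ... | false = ≤-refl
  ... | true = ⊥-elim (isZero-false Qx≢0 (trans (sym (eval-zeroOutside T P x)) (isZero-true Px)))
  root : ∀ x → isRootOf Q x ≡ true → 1ℚ - powℚ ½ r ≤ Prob (eval P) id (round x)
  root x _ with isZero (eval P (zeroOutside T x))
  ... | true = nonZeroTest-nonZero P s T D r nz deg 2D≤2^s
  ... | false = 1-p≤1 (powℚ-nonNeg r 0≤½)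

-- Eliminating variables one at a time

eliminate : ∀ {n B} → ℕ → ℕ → List (Fin n) → Vec Bool n → (Vec Bool n → Alg n B) → Alg n B
eliminate s r [] S k = k S
eliminate s r (i ∷ is) S k =
  nonZeroTest s (S [ i ]≔ false) r >>= λ b → eliminate s r is (if b then S [ i ]≔ false else S) k

false≢true : ¬ false ≡ true
false≢true ()

_⊆_ : ∀ {n} → Vec Bool n → Vec Bool n → Set
A ⊆ B = ∀ j → lookup A j ≡ true → lookup B j ≡ true

supportedIn-mono : ∀ {n} (A B : Vec Bool n) e → A ⊆ B → supportedIn A e ≡ true → supportedIn B e ≡ true
supportedIn-mono [] [] [] _ _ = refl
supportedIn-mono (a ∷ A) (b ∷ B) (zero ∷ e) A⊆B e∈A = supportedIn-mono A B e (λ j → A⊆B (Fin.suc j)) e∈A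
supportedIn-mono (true ∷ A) (b ∷ B) (suc _ ∷ e) A⊆B e∈A rewrite A⊆B Fin.zero refl =
  supportedIn-mono A B e (λ j → A⊆B (Fin.suc j)) e∈A

identicallyZero-restrict-⊆ : ∀ {n} (P : Poly n) A B → A ⊆ B →
                             IdenticallyZero (restrict B P) → IdenticallyZero (restrict A P)
identicallyZero-restrict-⊆ P A B A⊆B B-zero f with supportedIn A f in f∈A
... | true = trans (coeff-restrict-in A P f f∈A)
                   (trans (sym (coeff-restrict-in B P f (supportedIn-mono A B f A⊆B f∈A))) (B-zero f))
... | false = coeff-restrict-out A P f f∈A

degreeAtMost-restrict : ∀ {n} (P : Poly n) T {D} → DegreeAtMost P D → DegreeAtMost (restrict T P) D
degreeAtMost-restrict P T deg f f∈PT with supportedIn T f in f∈T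
... | true = deg f (λ z → f∈PT (trans (coeff-restrict-in T P f f∈T) z))
... | false = ⊥-elim (f∈PT (coeff-restrict-out T P f f∈T))

removed-⊆ : ∀ {n} (S : Vec Bool n) i → (S [ i ]≔ false) ⊆ S
removed-⊆ S i k k∈ with k FinP.≟ i
... | yes refl = ⊥-elim (false≢true (trans (sym (lookup∘update k S false)) k∈))
... | no k≢i = trans (sym (lookup∘update′ k≢i S false)) k∈

removed-twice-⊆ : ∀ {n} (S : Vec Bool n) i j → ((S [ i ]≔ false) [ j ]≔ false) ⊆ (S [ j ]≔ false)
removed-twice-⊆ S i j k k∈ with k FinP.≟ j
... | yes refl = ⊥-elim (false≢true (trans (sym (lookup∘update k (S [ i ]≔ false) false)) k∈))
... | no k≢j = trans (lookup∘update′ k≢j S false)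
                     (removed-⊆ S i k (trans (sym (lookup∘update′ k≢j (S [ i ]≔ false) false)) k∈))

MinimalExcept : ∀ {n} → Poly n → List (Fin n) → Vec Bool n → Set
MinimalExcept P is S = NonZeroPoly (restrict S P) ×
                       (∀ j → ¬ (j ∈ is) → lookup S j ≡ true → IdenticallyZero (restrict (S [ j ]≔ false) P))

minimalExcept-initial : ∀ {n} (P : Poly n) → NonZeroPoly P → MinimalExcept P (allFin n) (replicate n true)
minimalExcept-initial {n} P (e , e∈P) =
  (e , λ z → e∈P (trans (sym (coeff-restrict-in _ P e (supported-everywhere e))) z)) ,
  λ j j∉ _ → ⊥-elim (j∉ (∈-allFin j))
  where
  supported-everywhere : ∀ {m} (e : Monomial m) → supportedIn (replicate m true) e ≡ true
  supported-everywhere [] = refl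
  supported-everywhere (zero ∷ e) = supported-everywhere e
  supported-everywhere (suc _ ∷ e) = supported-everywhere e

minimalExcept-remove : ∀ {n} (P : Poly n) i is S → MinimalExcept P (i ∷ is) S →
                       NonZeroPoly (restrict (S [ i ]≔ false) P) → MinimalExcept P is (S [ i ]≔ false)
minimalExcept-remove P i is S (_ , minimal) nz = nz , λ j j∉is j∈S' → still-minimal (j FinP.≟ i) j∉is j∈S'
  where
  still-minimal : ∀ {j} → Dec (j ≡ i) → ¬ j ∈ is → lookup (S [ i ]≔ false) j ≡ true →
         IdenticallyZero (restrict ((S [ i ]≔ false) [ j ]≔ false) P)
  still-minimal {j} (yes refl) _ j∈S' with () ← trans (sym (lookup∘update j S false)) j∈S'
  still-minimal {j} (no j≢i) j∉is j∈S' = identicallyZero-restrict-⊆ P _ _ (removed-twice-⊆ S i j)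
    (minimal j (λ { (here j≡i) → j≢i j≡i ; (there j∈is) → j∉is j∈is }) (trans (sym (lookup∘update′ j≢i S false)) j∈S'))

minimalExcept-keep : ∀ {n} (P : Poly n) i is S → MinimalExcept P (i ∷ is) S →
                     ¬ NonZeroPoly (restrict (S [ i ]≔ false) P) → MinimalExcept P is S
minimalExcept-keep P i is S (nz , minimal) i-needed = nz , λ j j∉is j∈S → still-minimal (j FinP.≟ i) j∉is j∈S
  where
  still-minimal : ∀ {j} → Dec (j ≡ i) → ¬ j ∈ is → lookup S j ≡ true → IdenticallyZero (restrict (S [ j ]≔ false) P)
  still-minimal (yes refl) _ _ = ¬nonZero⇒identicallyZero (restrict (S [ i ]≔ false) P) i-needed
  still-minimal {j} (no j≢i) j∉is j∈S = minimal j (λ { (here j≡i) → j≢i j≡i ; (there j∈is) → j∉is j∈is }) j∈S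

-- Each test answers correctly with probability ≥ 1 - ½^r, and keeps the invariant when it does.
Prob-eliminate : ∀ {n} (P : Poly n) D s r (k : Vec Bool n → Alg n (Output n)) →
  DegreeAtMost P D → 2 ℕ.* D ℕ.≤ 2 ^ s →
  (∀ S → MinimalExcept P [] S → 1ℚ ≤ Prob (eval P) (correctB P) (k S)) →
  ∀ is S → MinimalExcept P is S → powℚ (1ℚ - powℚ ½ r) (length is) ≤ Prob (eval P) (correctB P) (eliminate s r is S k)
Prob-eliminate P D s r k deg 2D≤2^s final [] S minimal = final S minimal
Prob-eliminate P D s r k deg 2D≤2^s final (i ∷ is) S minimal with nonZero? (restrict (S [ i ]≔ false) P)
... | yes nz = begin
  (1ℚ - powℚ ½ r) * rest                       ≡⟨ *-comm (1ℚ - powℚ ½ r) rest ⟩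
  rest * (1ℚ - powℚ ½ r)                       ≤⟨ *-monoˡ-≤-nonNeg rest {{ℚ.nonNegative 0≤rest}}
                                                    (nonZeroTest-nonZero P s (S [ i ]≔ false) D r nz (degreeAtMost-restrict P _ deg) 2D≤2^s) ⟩
  rest * Prob (eval P) id (nonZeroTest s (S [ i ]≔ false) r)
                                               ≤⟨ Prob->>= (eval P) id (correctB P) rest _ 0≤rest
                                                    (λ { true _ → Prob-eliminate P D s r k deg 2D≤2^s final is _
                                                                    (minimalExcept-remove P i is S minimal nz) })
                                                    (nonZeroTest s (S [ i ]≔ false) r) ⟩
  Prob (eval P) (correctB P) (eliminate s r (i ∷ is) S k) ∎
  where
  open ≤-Reasoning
  rest = powℚ (1ℚ - powℚ ½ r) (length is)
  0≤rest = powℚ-nonNeg (length is) (0≤1-p (powℚ-≤1 r 0≤½ ½≤1))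
... | no ¬nz = begin
  (1ℚ - powℚ ½ r) * rest                       ≤⟨ *-monoʳ-≤-nonNeg rest {{ℚ.nonNegative 0≤rest}} (1-p≤1 (powℚ-nonNeg r 0≤½)) ⟩
  1ℚ * rest                                    ≡⟨ *-comm 1ℚ rest ⟩
  rest * 1ℚ                                    ≤⟨ *-monoˡ-≤-nonNeg rest {{ℚ.nonNegative 0≤rest}}
                                                    (nonZeroTest-identicallyZero P s (S [ i ]≔ false) r
                                                      (¬nonZero⇒identicallyZero (restrict (S [ i ]≔ false) P) ¬nz)) ⟩
  rest * Prob (eval P) not (nonZeroTest s (S [ i ]≔ false) r)
                                               ≤⟨ Prob->>= (eval P) not (correctB P) rest _ 0≤rest
                                                    (λ { false _ → Prob-eliminate P D s r k deg 2D≤2^s final is S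
                                                                     (minimalExcept-keep P i is S minimal ¬nz) })
                                                    (nonZeroTest s (S [ i ]≔ false) r) ⟩
  Prob (eval P) (correctB P) (eliminate s r (i ∷ is) S k) ∎
  where
  open ≤-Reasoning
  rest = powℚ (1ℚ - powℚ ½ r) (length is)
  0≤rest = powℚ-nonNeg (length is) (0≤1-p (powℚ-≤1 r 0≤½ ½≤1))

queriesBounded-eliminate : ∀ {n B} (P : Poly n) s r q (k : Vec Bool n → Alg n B) →
  (∀ S → QueriesBounded (eval P) q s (k S)) →
  ∀ is S → QueriesBounded (eval P) (length is ℕ.* r ℕ.+ q) s (eliminate s r is S k)
queriesBounded-eliminate P s r q k bounded [] S = bounded S
queriesBounded-eliminate P s r q k bounded (i ∷ is) S =
  queriesBounded-mono (eval P) s (ℕP.≤-reflexive (sym (ℕP.+-assoc r (length is ℕ.* r) q))) _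
    (queriesBounded->>= (eval P) r (length is ℕ.* r ℕ.+ q) s (nonZeroTest s (S [ i ]≔ false) r) _
      (queriesBounded-nonZeroTest P s (S [ i ]≔ false) r)
      (λ b → queriesBounded-eliminate P s r q k bounded is _))

-- Reading off a polynomial that consists of a single monomial

ones : ∀ n → Vec ℤ n
ones n = replicate n (ℤ.+ 1)

-- the least e ∈ [j, j + k) with c · 2^e = v (or 0 if none)
exponentSearch : ℚ → ℚ → ℕ → ℕ → ℕ
exponentSearch c v j zero = 0
exponentSearch c v j (suc k) with c * powℚ (fromℕ 2) j ℚ.≟ v
... | yes _ = j
... | no _ = exponentSearch c v (suc j) k

-- the exponent of Xᵢ, read off from the value c at ones (for D ≤ 1 it can only be 1)
probeExponent : ∀ {n} → ℕ → Vec Bool n → ℚ → Fin n → Alg n ℕ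
probeExponent {n} D@(suc (suc _)) S c i =
  query (zeroOutside S (ones n [ i ]≔ ℤ.+ 2)) (λ v → ret (exponentSearch c v 0 (suc D)))
probeExponent _ S c i = ret 1

readExponent : ∀ {n} → ℕ → Vec Bool n → ℚ → Fin n → Alg n ℕ
readExponent D S c i = if lookup S i then probeExponent D S c i else ret 0

collectAll : ∀ {n B m} → (Fin m → Alg n ℕ) → (Vec ℕ m → Alg n B) → Alg n B
collectAll {m = zero} f k = k []
collectAll {m = suc m} f k = f Fin.zero >>= λ a → collectAll (λ i → f (Fin.suc i)) (λ v → k (a ∷ v))

readMonomial : ∀ {n} → ℕ → Vec Bool n → Alg n (Output n)
readMonomial {n} D S = query (zeroOutside S (ones n)) (λ c → collectAll (readExponent D S c) (λ e → ret (just (e , c))))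

Prob-collectAll : ∀ {n B m} (O : Vec ℤ n → ℚ) (S : B → Bool) (f : Fin m → Alg n ℕ) (k : Vec ℕ m → Alg n B) e →
                  (∀ i → Returns O (f i) (lookup e i)) → Prob O S (collectAll f k) ≡ Prob O S (k e)
Prob-collectAll {m = zero} O S f k [] _ = refl
Prob-collectAll {m = suc m} O S f k (a ∷ e) returns =
  trans (Prob->>=-deterministic O S (f Fin.zero) a _ (returns Fin.zero))
        (Prob-collectAll O S (λ i → f (Fin.suc i)) (λ v → k (a ∷ v)) e (λ i → returns (Fin.suc i)))

queriesBounded-collectAll : ∀ {n B m} (O : Vec ℤ n → ℚ) q s (f : Fin m → Alg n ℕ) (k : Vec ℕ m → Alg n B) →
  (∀ i → QueriesBounded O 1 s (f i)) → (∀ v → QueriesBounded O q s (k v)) → QueriesBounded O (m ℕ.+ q) s (collectAll f k)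
queriesBounded-collectAll {m = zero} O q s f k _ bk = bk []
queriesBounded-collectAll {m = suc m} O q s f k bf bk =
  queriesBounded->>= O 1 (m ℕ.+ q) s (f Fin.zero) _ (bf Fin.zero)
    (λ a → queriesBounded-collectAll O q s _ _ (λ i → bf (Fin.suc i)) (λ v → bk (a ∷ v)))

queriesBounded-readMonomial : ∀ {n} (P : Poly n) D s → 1 ℕ.≤ s → (2 ℕ.≤ D → 2 ℕ.≤ s) → ∀ S →
                              QueriesBounded (eval P) (suc n) s (readMonomial D S)
queriesBounded-readMonomial {n} P D s 1≤s 2≤s S =
  zeroOutside-sizes S (ones n) (λ i → subst (λ z → sizeℤ z ℕ.≤ s) (sym (lookup-replicate i (ℤ.+ 1))) 1≤s) ,
  subst (λ q → QueriesBounded (eval P) q s (collectAll (readExponent D S c) (λ e → ret (just (e , c)))))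
        (ℕP.+-identityʳ n) (queriesBounded-collectAll (eval P) 0 s _ _ one-query (λ _ → tt))
  where
  c = eval P (zeroOutside S (ones n))
  twos-sizes : 2 ℕ.≤ s → ∀ j i → sizeℤ (lookup (ones n [ j ]≔ ℤ.+ 2) i) ℕ.≤ s
  twos-sizes 2≤s j i with i FinP.≟ j
  ... | yes refl rewrite lookup∘update i (ones n) (ℤ.+ 2) = 2≤s
  ... | no i≢j rewrite lookup∘update′ i≢j (ones n) (ℤ.+ 2) | lookup-replicate i (ℤ.+ 1) = 1≤s
  one-query : ∀ i → QueriesBounded (eval P) 1 s (readExponent D S c i)
  one-query i with lookup S i
  ... | false = tt
  ... | true = probe-query D 2≤s
    where
    probe-query : ∀ D' → (2 ℕ.≤ D' → 2 ℕ.≤ s) →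
                  QueriesBounded (eval P) 1 s (probeExponent D' S c i)
    probe-query zero _ = tt
    probe-query (suc zero) _ = tt
    probe-query (suc (suc _)) 2≤s = zeroOutside-sizes S _ (twos-sizes (2≤s (ℕ.s≤s (ℕ.s≤s ℕ.z≤n))) i) , tt

supportedIn-remove : ∀ {n} (S : Vec Bool n) e j → supportedIn S e ≡ true → lookup e j ≡ 0 →
                     supportedIn (S [ j ]≔ false) e ≡ true
supportedIn-remove (b ∷ S) (zero ∷ e) Fin.zero e∈S _ = e∈S
supportedIn-remove (b ∷ S) (zero ∷ e) (Fin.suc j) e∈S eⱼ≡0 = supportedIn-remove S e j e∈S eⱼ≡0
supportedIn-remove (true ∷ S) (suc _ ∷ e) (Fin.suc j) e∈S eⱼ≡0 = supportedIn-remove S e j e∈S eⱼ≡0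

supportedIn-outside : ∀ {n} (S : Vec Bool n) e j → supportedIn S e ≡ true → lookup S j ≡ false → lookup e j ≡ 0
supportedIn-outside (b ∷ S) (zero ∷ e) Fin.zero _ _ = refl
supportedIn-outside (true ∷ S) (suc _ ∷ e) Fin.zero _ ()
supportedIn-outside (b ∷ S) (zero ∷ e) (Fin.suc j) e∈S j∉S = supportedIn-outside S e j e∈S j∉S
supportedIn-outside (true ∷ S) (suc _ ∷ e) (Fin.suc j) e∈S j∉S = supportedIn-outside S e j e∈S j∉S

support-≡ : ∀ {n} (S : Vec Bool n) (f : Monomial n) → (∀ j → lookup S j ≡ true → ¬ lookup f j ≡ 0) →
            (∀ j → lookup S j ≡ false → lookup f j ≡ 0) → support f ≡ S
support-≡ [] [] _ _ = refl
support-≡ (true ∷ S) (zero ∷ f) inside _ = ⊥-elim (inside Fin.zero refl refl)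
support-≡ (true ∷ S) (suc _ ∷ f) inside outside =
  cong (true ∷_) (support-≡ S f (λ j → inside (Fin.suc j)) (λ j → outside (Fin.suc j)))
support-≡ (false ∷ S) (zero ∷ f) inside outside =
  cong (false ∷_) (support-≡ S f (λ j → inside (Fin.suc j)) (λ j → outside (Fin.suc j)))
support-≡ (false ∷ S) (suc _ ∷ f) _ outside with () ← outside Fin.zero refl

support-minimal : ∀ {n} (P : Poly n) S → MinimalExcept P [] S → ∀ f → IsMonomialOf f (restrict S P) →
                  IsMonomialOf f P × supportedIn S f ≡ true × support f ≡ S
support-minimal P S (_ , minimal) f f∈PS = f∈P , f∈S , support-≡ S f uses-all (λ j → supportedIn-outside S f j f∈S)
  where
  f∈S : supportedIn S f ≡ true
  f∈S with supportedIn S f in f∈S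
  ... | true = refl
  ... | false = ⊥-elim (f∈PS (coeff-restrict-out S P f f∈S))
  f∈P : IsMonomialOf f P
  f∈P z = f∈PS (trans (coeff-restrict-in S P f f∈S) z)
  uses-all : ∀ j → lookup S j ≡ true → ¬ lookup f j ≡ 0
  uses-all j j∈S fⱼ≡0 = f∈P (begin
    coeff P f                          ≡⟨ coeff-restrict-in _ P f (supportedIn-remove S f j f∈S fⱼ≡0) ⟨
    coeff (restrict (S [ j ]≔ false) P) f ≡⟨ minimal j (λ ()) j∈S f ⟩
    0ℚ                                 ∎)
    where open ≡-Reasoning

minimal⇒monomial : ∀ {n} (P : Poly n) S → DistinctSupports P → MinimalExcept P [] S →
  ∃ λ e → IsMonomialOf e P × support e ≡ S × (∀ x → eval P (zeroOutside S x) ≡ coeff P e * evalMono e x)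
minimal⇒monomial P S distinct minimal@((e , e∈PS) , _) =
  e , e∈P , proj₂ (proj₂ (support-minimal P S minimal e e∈PS)) , λ x → begin
    eval P (zeroOutside S x)                  ≡⟨ eval-zeroOutside S P x ⟩
    eval (restrict S P) x                     ≡⟨ eval-single (restrict S P) e only-e x ⟩
    coeff (restrict S P) e * evalMono e x     ≡⟨ cong (_* evalMono e x) (coeff-restrict-in S P e e∈S) ⟩
    coeff P e * evalMono e x                  ∎
  where
  open ≡-Reasoning
  e∈P = proj₁ (support-minimal P S minimal e e∈PS)
  e∈S = proj₁ (proj₂ (support-minimal P S minimal e e∈PS))
  only-e : ∀ f → ¬ f ≡ e → coeff (restrict S P) f ≡ 0ℚ
  only-e f f≢e with coeff (restrict S P) f ℚ.≟ 0ℚ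
  ... | yes f∉PS = f∉PS
  ... | no f∈PS = ⊥-elim (f≢e (distinct f e (proj₁ (support-minimal P S minimal f f∈PS)) e∈P
                    (trans (proj₂ (proj₂ (support-minimal P S minimal f f∈PS)))
                           (sym (proj₂ (proj₂ (support-minimal P S minimal e e∈PS)))))))

support-false : ∀ {n} (e : Monomial n) i → lookup (support e) i ≡ false → lookup e i ≡ 0
support-false (zero ∷ e) Fin.zero _ = refl
support-false (zero ∷ e) (Fin.suc i) eᵢ∉ = support-false e i eᵢ∉
support-false (suc _ ∷ e) (Fin.suc i) eᵢ∉ = support-false e i eᵢ∉

support-true : ∀ {n} (e : Monomial n) i → lookup (support e) i ≡ true → ¬ lookup e i ≡ 0
support-true (suc _ ∷ e) Fin.zero _ ()
support-true (zero ∷ e) (Fin.suc i) eᵢ∈ = support-true e i eᵢ∈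
support-true (suc _ ∷ e) (Fin.suc i) eᵢ∈ = support-true e i eᵢ∈

lookup≤totalDeg : ∀ {n} (e : Monomial n) i → lookup e i ℕ.≤ totalDeg e
lookup≤totalDeg (x ∷ e) Fin.zero = ℕP.m≤m+n x _
lookup≤totalDeg (x ∷ e) (Fin.suc i) = ℕP.≤-trans (lookup≤totalDeg e i) (ℕP.m≤n+m _ x)

powℚ-1 : ∀ k → powℚ 1ℚ k ≡ 1ℚ
powℚ-1 zero = refl
powℚ-1 (suc k) = trans (*-identityˡ _) (powℚ-1 k)

evalMono-ones : ∀ {n} (e : Monomial n) → evalMono e (ones n) ≡ 1ℚ
evalMono-ones [] = refl
evalMono-ones (x ∷ e) = trans (cong₂ _*_ (powℚ-1 x) (evalMono-ones e)) (*-identityˡ 1ℚ)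

evalMono-ones-2 : ∀ {n} (e : Monomial n) i → evalMono e (ones n [ i ]≔ ℤ.+ 2) ≡ powℚ (fromℕ 2) (lookup e i)
evalMono-ones-2 (x ∷ e) Fin.zero = trans (cong (powℚ (fromℕ 2) x *_) (evalMono-ones e)) (*-identityʳ _)
evalMono-ones-2 (x ∷ e) (Fin.suc i) = trans (cong₂ _*_ (powℚ-1 x) (evalMono-ones-2 e i)) (*-identityˡ _)

powℚ-2-injective : ∀ a b → powℚ (fromℕ 2) a ≡ powℚ (fromℕ 2) b → a ≡ b
powℚ-2-injective a b eq = begin
  a                 ≡⟨ ⌊log₂[2^n]⌋≡n a ⟨
  ⌊log₂ 2 ^ a ⌋     ≡⟨ cong ⌊log₂_⌋ (fromℕ-injective (2 ^ a) (2 ^ b) (trans (fromℕ-^ 2 a) (trans eq (sym (fromℕ-^ 2 b))))) ⟩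
  ⌊log₂ 2 ^ b ⌋     ≡⟨ ⌊log₂[2^n]⌋≡n b ⟩
  b                 ∎
  where open ≡-Reasoning

exponentSearch-correct : ∀ c j k e → ¬ c ≡ 0ℚ → j ℕ.≤ e → e ℕ.< j ℕ.+ k →
                         exponentSearch c (c * powℚ (fromℕ 2) e) j k ≡ e
exponentSearch-correct c j zero e c≢0 j≤e e<j+0 = ⊥-elim (ℕP.<⇒≱ e<j+0 (subst (ℕ._≤ e) (sym (ℕP.+-identityʳ j)) j≤e))
exponentSearch-correct c j (suc k) e c≢0 j≤e e<j+k+1 with c * powℚ (fromℕ 2) j ℚ.≟ c * powℚ (fromℕ 2) e
... | yes found = powℚ-2-injective j e (*-cancelˡ-≢0 c _ _ c≢0 found)
... | no differ = exponentSearch-correct c (suc j) k e c≢0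
                    (ℕP.≤∧≢⇒< j≤e (λ j≡e → differ (cong (λ z → c * powℚ (fromℕ 2) z) j≡e)))
                    (subst (e ℕ.<_) (ℕP.+-suc j k) e<j+k+1)

correctB-true : ∀ {n} (P : Poly n) e c → IsMonomialOf e P → coeff P e ≡ c → correctB P (just (e , c)) ≡ true
correctB-true P e c e∈P eq with coeff P e ℚ.≟ 0ℚ
... | yes e∉P = ⊥-elim (e∈P e∉P)
... | no _ with coeff P e ℚ.≟ c
...   | yes _ = refl
...   | no ne = ⊥-elim (ne eq)

readMonomial-correct : ∀ {n} (P : Poly n) D S → DistinctSupports P → DegreeAtMost P D → 1 ℕ.≤ D →
                       MinimalExcept P [] S → 1ℚ ≤ Prob (eval P) (correctB P) (readMonomial D S)
readMonomial-correct {n} P D S distinct deg 1≤D minimal = ≤-reflexive (sym (begin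
  Prob (eval P) (correctB P) (readMonomial D S)       ≡⟨ Prob-collectAll (eval P) (correctB P) _ _ e reads-eᵢ ⟩
  Prob (eval P) (correctB P) (ret (just (e , c)))     ≡⟨ Prob-ret (eval P) (correctB P) _ (correctB-true P e c e∈P (sym c≡)) ⟩
  1ℚ                                                  ∎))
  where
  open ≡-Reasoning
  e = proj₁ (minimal⇒monomial P S distinct minimal)
  e∈P = proj₁ (proj₂ (minimal⇒monomial P S distinct minimal))
  supp-e = proj₁ (proj₂ (proj₂ (minimal⇒monomial P S distinct minimal)))
  P-on-S = proj₂ (proj₂ (proj₂ (minimal⇒monomial P S distinct minimal)))
  c = eval P (zeroOutside S (ones n))
  c≡ : c ≡ coeff P e
  c≡ = trans (P-on-S (ones n)) (trans (cong (coeff P e *_) (evalMono-ones e)) (*-identityʳ _))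
  eᵢ≤D : ∀ i → lookup e i ℕ.≤ D
  eᵢ≤D i = ℕP.≤-trans (lookup≤totalDeg e i) (deg e e∈P)
  reads-eᵢ : ∀ i → Returns (eval P) (readExponent D S c i) (lookup e i)
  reads-eᵢ i with lookup S i in i∈S
  ... | false = sym (support-false e i (trans (cong (λ T → lookup T i) supp-e) i∈S))
  ... | true = probe-returns D 1≤D (eᵢ≤D i)
    where
    eᵢ≢0 : ¬ lookup e i ≡ 0
    eᵢ≢0 = support-true e i (trans (cong (λ T → lookup T i) supp-e) i∈S)
    probe-returns : ∀ D' → 1 ℕ.≤ D' → lookup e i ℕ.≤ D' → Returns (eval P) (probeExponent D' S c i) (lookup e i)
    probe-returns (suc zero) _ eᵢ≤1 = ℕP.≤-antisym (ℕP.n≢0⇒n>0 eᵢ≢0) eᵢ≤1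
    probe-returns D'@(suc (suc _)) _ eᵢ≤D' = begin
      exponentSearch c (eval P (zeroOutside S (ones n [ i ]≔ ℤ.+ 2))) 0 (suc D')
        ≡⟨ cong₂ (λ a b → exponentSearch a b 0 (suc D')) c≡
             (trans (P-on-S _) (cong (coeff P e *_) (evalMono-ones-2 e i))) ⟩
      exponentSearch (coeff P e) (coeff P e * powℚ (fromℕ 2) (lookup e i)) 0 (suc D')
        ≡⟨ exponentSearch-correct (coeff P e) 0 (suc D') (lookup e i) e∈P ℕ.z≤n (ℕ.s≤s eᵢ≤D') ⟩
      lookup e i ∎

fromℕ-toℚᵘ : ∀ m → ℚ.toℚᵘ (fromℕ m) ℚᵘ.≃ ℚᵘ.mkℚᵘ (ℤ.+ m) 0
fromℕ-toℚᵘ zero = ℚᵘ.*≡* refl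
fromℕ-toℚᵘ (suc m) = ℚᵘP.≃-trans (toℚᵘ-homo-+ 1ℚ (fromℕ m))
  (ℚᵘP.≃-trans (ℚᵘP.+-cong (ℚᵘP.≃-refl {ℚᵘ.mkℚᵘ (ℤ.+ 1) 0}) (fromℕ-toℚᵘ m)) (ℚᵘ.*≡* (identity (ℤ.+ m))))
  where identity : ∀ x → (ℤ.+ 1 ℤ.* ℤ.+ 1 ℤ.+ x ℤ.* ℤ.+ 1) ℤ.* ℤ.+ 1 ≡ (ℤ.+ 1 ℤ.+ x) ℤ.* (ℤ.+ 1 ℤ.* ℤ.+ 1)
        identity = ℤ-Solver.solve-∀

ε*denominator : ∀ ε → 0ℚ < ε → ε * fromℕ (ℚ.↧ₙ ε) ≡ fromℕ ℤ.∣ ℚ.↥ ε ∣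
ε*denominator ε@(ℚ.mkℚ (ℤ.+ a) d-1 _) _ = toℚᵘ-injective (begin
  ℚ.toℚᵘ (ε * fromℕ (suc d-1))                                 ≈⟨ toℚᵘ-homo-* ε (fromℕ (suc d-1)) ⟩
  ℚᵘ.mkℚᵘ (ℤ.+ a) d-1 ℚᵘ.* ℚ.toℚᵘ (fromℕ (suc d-1))            ≈⟨ ℚᵘP.*-congˡ {ℚᵘ.mkℚᵘ (ℤ.+ a) d-1} (fromℕ-toℚᵘ (suc d-1)) ⟩
  ℚᵘ.mkℚᵘ (ℤ.+ a) d-1 ℚᵘ.* ℚᵘ.mkℚᵘ (ℤ.+ suc d-1) 0            ≈⟨ ℚᵘ.*≡* (identity (ℤ.+ a) (ℤ.+ suc d-1)) ⟩
  ℚᵘ.mkℚᵘ (ℤ.+ a) 0                                            ≈⟨ fromℕ-toℚᵘ a ⟨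
  ℚ.toℚᵘ (fromℕ a)                                             ∎)
  where
  open ℚᵘP.≃-Reasoning
  identity : ∀ a d → a ℤ.* d ℤ.* ℤ.+ 1 ≡ a ℤ.* (d ℤ.* ℤ.+ 1)
  identity = ℤ-Solver.solve-∀
ε*denominator (ℚ.mkℚ ℤ.-[1+ _ ] _ _) (ℚ.*<* ())

ceilDiv-* : ∀ m b → m ℕ.≤ ceilDiv m (suc b) ℕ.* suc b
ceilDiv-* m b = ℕP.+-cancelʳ-≤ b m _ (begin
  m ℕ.+ b                                              ≡⟨ m≡m%n+[m/n]*n (m ℕ.+ b) (suc b) ⟩
  (m ℕ.+ b) % suc b ℕ.+ (m ℕ.+ b) / suc b ℕ.* suc b    ≤⟨ ℕP.+-monoˡ-≤ _ (ℕP.≤-pred (m%n<n (m ℕ.+ b) (suc b))) ⟩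
  b ℕ.+ (m ℕ.+ b) / suc b ℕ.* suc b                    ≡⟨ ℕP.+-comm b _ ⟩
  (m ℕ.+ b) / suc b ℕ.* suc b ℕ.+ b                    ∎)
  where open ℕP.≤-Reasoning

n≤2^rounds*ε : ∀ n ε → 0ℚ < ε → fromℕ n ≤ fromℕ (2 ^ ⌈log₂ ceil-n/ε n ε ⌉) * ε
n≤2^rounds*ε n ε@(ℚ.mkℚ (ℤ.+ zero) _ _) (ℚ.*<* 0<0) = ⊥-elim (ℤP.<-irrefl refl 0<0)
n≤2^rounds*ε n ε@(ℚ.mkℚ (ℤ.+ suc a-1) d-1 _) 0<ε = *-cancelʳ-≤-pos (fromℕ d) {{ℚ.positive (fromℕ-pos d-1)}} (begin
  fromℕ n * fromℕ d                ≡⟨ fromℕ-* n d ⟨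
  fromℕ (n ℕ.* d)                  ≤⟨ fromℕ-mono-≤ (ℕP.≤-trans (ceilDiv-* (n ℕ.* d) a-1)
                                        (ℕP.*-monoˡ-≤ a (n≤2^⌈log₂n⌉ (ceil-n/ε n ε)))) ⟩
  fromℕ (2 ^ L ℕ.* a)              ≡⟨ fromℕ-* (2 ^ L) a ⟩
  fromℕ (2 ^ L) * fromℕ a          ≡⟨ cong (fromℕ (2 ^ L) *_) (ε*denominator ε 0<ε) ⟨
  fromℕ (2 ^ L) * (ε * fromℕ d)    ≡⟨ *-assoc (fromℕ (2 ^ L)) ε (fromℕ d) ⟨
  fromℕ (2 ^ L) * ε * fromℕ d      ∎)
  where
  open ≤-Reasoning
  a = suc a-1
  d = suc d-1
  L = ⌈log₂ ceil-n/ε n ε ⌉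

rounds : ℕ → ℚ → ℕ
rounds n ε = ⌈log₂ ceil-n/ε n ε ⌉

n*½^rounds≤ε : ∀ n ε → 0ℚ < ε → fromℕ n * powℚ ½ (rounds n ε) ≤ ε
n*½^rounds≤ε n ε 0<ε = begin
  fromℕ n * powℚ ½ L                         ≤⟨ *-monoʳ-≤-nonNeg (powℚ ½ L) {{ℚ.nonNegative (powℚ-nonNeg L 0≤½)}}
                                                  (n≤2^rounds*ε n ε 0<ε) ⟩
  fromℕ (2 ^ L) * ε * powℚ ½ L               ≡⟨ regroup (fromℕ (2 ^ L)) ε (powℚ ½ L) ⟩
  ε * (fromℕ (2 ^ L) * powℚ ½ L)             ≡⟨ cong (ε *_) (fromℕ-2^*½^ L) ⟩
  ε * 1ℚ                                     ≡⟨ *-identityʳ ε ⟩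
  ε                                          ∎
  where
  open ≤-Reasoning
  L = rounds n ε
  regroup : ∀ t e h → t * e * h ≡ e * (t * h)
  regroup = solve-∀ ℚ-ring

rounds≡0⇒n≡0 : ∀ n ε → 0ℚ < ε → ε < 1ℚ → rounds n ε ≡ 0 → n ≡ 0
rounds≡0⇒n≡0 n ε 0<ε ε<1 L≡0 = fromℕ≤p<1⇒0 n
  (≤-trans (n≤2^rounds*ε n ε 0<ε) (≤-reflexive (trans (cong (λ L → fromℕ (2 ^ L) * ε) L≡0) (*-identityˡ ε)))) ε<1

-- n ≤ nL unless L = 0, and then n = 0
query-budget : ∀ n L → (L ≡ 0 → n ≡ 0) → n ℕ.* L ℕ.+ suc n ℕ.≤ 2 ℕ.* (n ℕ.* L ℕ.+ 1)
query-budget n zero L≡0⇒n≡0 rewrite L≡0⇒n≡0 refl = ℕ.s≤s ℕ.z≤n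
query-budget n L@(suc _) _ = begin
  n ℕ.* L ℕ.+ suc n              ≤⟨ ℕP.+-monoʳ-≤ (n ℕ.* L) (ℕ.s≤s (ℕP.m≤m*n n L)) ⟩
  n ℕ.* L ℕ.+ suc (n ℕ.* L)      ≤⟨ ℕP.n≤1+n _ ⟩
  suc (n ℕ.* L ℕ.+ suc (n ℕ.* L)) ≡⟨ double (n ℕ.* L) ⟩
  2 ℕ.* (n ℕ.* L ℕ.+ 1)          ∎
  where
  open ℕP.≤-Reasoning
  double : ∀ x → suc (x ℕ.+ suc x) ≡ 2 ℕ.* (x ℕ.+ 1)
  double = ℕ-Solver.solve-∀

length-allFin : ∀ n → length (allFin n) ≡ n
length-allFin n = length-tabulate {A = Fin n} id

constantTerm : (n : ℕ) → Alg n (Output n)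
constantTerm n = query (replicate n (ℤ.+ 0)) (λ v → ret (just (replicate n 0 , v)))

algorithm : (n D : ℕ) → ℚ → Alg n (Output n)
algorithm n zero ε = constantTerm n
algorithm n D@(suc _) ε = eliminate ⌈log₂ (2 ℕ.* D) ⌉ (rounds n ε) (allFin n) (replicate n true) (readMonomial D)

constantTerm-correct : ∀ {n} (P : Poly n) → DegreeAtMost P 0 → NonZeroPoly P →
                       1ℚ ≤ Prob (eval P) (correctB P) (constantTerm n)
constantTerm-correct {n} P deg (e , e∈P) = ≤-reflexive (sym (Prob-ret (eval P) (correctB P) _
  (correctB-true P 0ⁿ _ 0ⁿ∈P (sym (begin
    eval P (replicate n (ℤ.+ 0))                  ≡⟨ eval-single P 0ⁿ only-0ⁿ _ ⟩
    coeff P 0ⁿ * evalMono 0ⁿ (replicate n (ℤ.+ 0)) ≡⟨ cong (coeff P 0ⁿ *_) (evalMono-0ⁿ (replicate n (ℤ.+ 0))) ⟩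
    coeff P 0ⁿ * 1ℚ                               ≡⟨ *-identityʳ (coeff P 0ⁿ) ⟩
    coeff P 0ⁿ                                    ∎)))))
  where
  open ≡-Reasoning
  0ⁿ = replicate n 0
  degree-0 : ∀ {m} (f : Monomial m) → totalDeg f ℕ.≤ 0 → f ≡ replicate m 0
  degree-0 [] _ = refl
  degree-0 (zero ∷ f) f≤0 = cong (0 ∷_) (degree-0 f f≤0)
  evalMono-0ⁿ : ∀ {m} (x : Vec ℤ m) → evalMono (replicate m 0) x ≡ 1ℚ
  evalMono-0ⁿ [] = refl
  evalMono-0ⁿ (y ∷ x) = trans (*-identityˡ _) (evalMono-0ⁿ x)
  0ⁿ∈P : IsMonomialOf 0ⁿ P
  0ⁿ∈P = subst (λ f → IsMonomialOf f P) (degree-0 e (deg e e∈P)) e∈P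
  only-0ⁿ : ∀ f → ¬ f ≡ 0ⁿ → coeff P f ≡ 0ℚ
  only-0ⁿ f f≢0ⁿ with coeff P f ℚ.≟ 0ℚ
  ... | yes f∉P = f∉P
  ... | no f∈P = ⊥-elim (f≢0ⁿ (degree-0 f (deg f f∈P)))

algorithm-correct : ∀ n D ε → 0ℚ < ε → (P : Poly n) → DistinctSupports P → DegreeAtMost P D → NonZeroPoly P →
                    1ℚ - ε ≤ Prob (eval P) (correctB P) (algorithm n D ε)
algorithm-correct n zero ε 0<ε P _ deg nz = ≤-trans (1-p≤1 (<⇒≤ 0<ε)) (constantTerm-correct P deg nz)
algorithm-correct n D@(suc _) ε 0<ε P distinct deg nz = begin
  1ℚ - ε                                            ≤⟨ +-monoʳ-≤ 1ℚ (neg-antimono-≤ (n*½^rounds≤ε n ε 0<ε)) ⟩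
  1ℚ - fromℕ n * powℚ ½ L                           ≤⟨ bernoulli n (powℚ ½ L) (powℚ-nonNeg L 0≤½) (powℚ-≤1 L 0≤½ ½≤1) ⟩
  powℚ (1ℚ - powℚ ½ L) n                            ≡⟨ cong (powℚ (1ℚ - powℚ ½ L)) (length-allFin n) ⟨
  powℚ (1ℚ - powℚ ½ L) (length (allFin n))          ≤⟨ Prob-eliminate P D s L (readMonomial D) deg (n≤2^⌈log₂n⌉ (2 ℕ.* D))
                                                         (λ S → readMonomial-correct P D S distinct deg (ℕ.s≤s ℕ.z≤n))
                                                         (allFin n) (replicate n true) (minimalExcept-initial P nz) ⟩
  Prob (eval P) (correctB P) (algorithm n D ε)      ∎
  where
  open ≤-Reasoning
  L = rounds n ε
  s = ⌈log₂ (2 ℕ.* D) ⌉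

algorithm-queries : ∀ n D ε → 0ℚ < ε → ε < 1ℚ → (P : Poly n) →
                    QueriesBounded (eval P) (2 ℕ.* (n ℕ.* rounds n ε ℕ.+ 1)) ⌈log₂ (2 ℕ.* D) ⌉ (algorithm n D ε)
algorithm-queries n zero ε _ _ P = queriesBounded-mono (eval P) _
  (ℕP.≤-trans (ℕP.m≤n+m 1 (n ℕ.* rounds n ε)) (ℕP.m≤n*m _ 2)) (constantTerm n)
  ((λ i → subst (λ z → sizeℤ z ℕ.≤ _) (sym (lookup-replicate i (ℤ.+ 0))) ℕ.z≤n) , tt)
algorithm-queries n D@(suc _) ε 0<ε ε<1 P = queriesBounded-mono (eval P) s budget _
  (queriesBounded-eliminate P s L (suc n) (readMonomial D)
    (queriesBounded-readMonomial P D s (⌈log₂⌉-mono-≤ {2} {2 ℕ.* D} (ℕP.*-monoʳ-≤ 2 (ℕ.s≤s ℕ.z≤n)))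
                                       (λ 2≤D → ⌈log₂⌉-mono-≤ {4} {2 ℕ.* D} (ℕP.*-monoʳ-≤ 2 2≤D)))
    (allFin n) (replicate n true))
  where
  L = rounds n ε
  s = ⌈log₂ (2 ℕ.* D) ⌉
  budget : length (allFin n) ℕ.* L ℕ.+ suc n ℕ.≤ 2 ℕ.* (n ℕ.* L ℕ.+ 1)
  budget = subst (λ m → m ℕ.* L ℕ.+ suc n ℕ.≤ 2 ℕ.* (n ℕ.* L ℕ.+ 1)) (sym (length-allFin n))
                 (query-budget n L (rounds≡0⇒n≡0 n ε 0<ε ε<1))

proposition1 : ∃ λ (C : ℕ) →
  ∃ λ (A : (n D : ℕ) → ℚ → Alg n (Output n)) →
    ∀ (n D : ℕ) (ε : ℚ) → 0ℚ < ε → ε < 1ℚ →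
    ∀ (P : Poly n) → DistinctSupports P → HasTotalDegree P D →
      QueriesBounded (eval P) (C ℕ.* (n ℕ.* ⌈log₂ ceil-n/ε n ε ⌉ ℕ.+ 1)) ⌈log₂ (2 ℕ.* D) ⌉ (A n D ε)
      × (1ℚ - ε) ≤ Prob (eval P) (correctB P) (A n D ε)
proposition1 = 2 , algorithm , λ n D ε 0<ε ε<1 P distinct (deg , e , e∈P , _) →
  algorithm-queries n D ε 0<ε ε<1 P , algorithm-correct n D ε 0<ε P distinct deg (e , e∈P)
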